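{- Let $q > r \ge 1$ be integers. If $S_1$ and $S_2$ are $K_q^r$-cliques such that $S_1 \cap S_2 = \{e\}$ for some $r$-edge $e$, then there exists an independent $K_q^r$-hinge for $S_1$ and $S_2$.
   Context: An $r$-graph is identified with its edge set (a set of $r$-element subsets of its vertex set $V(G)$), so $S_1 \cap S_2$ denotes the set of common edges. $K_q^r$ is the complete $r$-graph on $q$ vertices, and a $K_q^r$-clique is an $r$-graph isomorphic to $K_q^r$. A $K_q^r$-decomposition of an $r$-graph $G$ is a partition of the edges of $G$ into $K_q^r$-cliques. Let $S, S'$ be $K_q^r$-cliques with $S \cap S' = \{e\}$ for an $r$-edge $e$. A $K_q^r$-hinge for $S$ and $S'$ is an $r$-graph $H$ that is edge-disjoint from $S \cup S'$ and such that $H \cup (S \setminus \{e\})$ has a $K_q^r$-decomposition and $H \cup (S' \setminus \{e\})$ has a $K_q^r$-decomposition. The hinge is independent if $V(S) \cup V(S')$ is independent in $H$, i.e. no edge of $H$ is contained in $V(S) \cup V(S')$. -}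

module Defs where

open import Data.Nat using (ℕ; _<_)
open import Data.List using (List; length; lookup)
open import Data.List.Relation.Unary.All using (All)
open import Data.List.Relation.Unary.Linked using (Linked)
open import Data.List.Membership.Propositional using (_∈_; _∉_)
open import Data.Fin using (Fin)
open import Data.Product using (Σ; ∃-syntax; _×_)
open import Data.Sum using (_⊎_)
open import Relation.Binary.PropositionalEquality using (_≡_; _≢_)
open import Relation.Nullary using (¬_)
open import Function.Bundles using (_⇔_)

-- Vertices are natural numbers (an unbounded supply of vertices).
-- A finite vertex set is represented canonically as a strictly increasing list.
Vertex : Set
Vertex = ℕ

Edge : Set
Edge = List Vertex

IsREdge : ℕ → Edge → Set
IsREdge r e = Linked _<_ e × length e ≡ r

RGraph : Set
RGraph = List Edge

IsRGraph : ℕ → RGraph → Set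
IsRGraph r G = All (IsREdge r) G

EdgeSet : Set₁
EdgeSet = Edge → Set

_ᴱ : RGraph → EdgeSet
(G ᴱ) f = f ∈ G

_∈V_ : Vertex → RGraph → Set
v ∈V G = ∃[ f ] (f ∈ G × v ∈ f)

IsClique : ℕ → ℕ → RGraph → Set
IsClique q r S =
  ∃[ X ] (Linked _<_ X × length X ≡ q ×
          (∀ f → (f ∈ S) ⇔ (IsREdge r f × All (_∈ X) f)))

HasDecomposition : ℕ → ℕ → EdgeSet → Set
HasDecomposition q r P =
  Σ (List RGraph) λ Ss →
    All (IsClique q r) Ss ×
    (∀ (i : Fin (length Ss)) f → f ∈ lookup Ss i → P f) ×
    (∀ f → P f → Σ (Fin (length Ss)) λ i →
        f ∈ lookup Ss i × (∀ j → f ∈ lookup Ss j → j ≡ i))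

UnionMinus : RGraph → RGraph → Edge → EdgeSet
UnionMinus H S e f = f ∈ H ⊎ (f ∈ S × f ≢ e)

IsHinge : ℕ → ℕ → RGraph → RGraph → Edge → RGraph → Set
IsHinge q r S S' e H =
  IsRGraph r H ×
  (∀ f → f ∈ H → f ∉ S × f ∉ S') ×
  HasDecomposition q r (UnionMinus H S e) ×
  HasDecomposition q r (UnionMinus H S' e)

IndependentIn : RGraph → RGraph → RGraph → Set
IndependentIn S S' H =
  ∀ f → f ∈ H → ¬ All (λ v → v ∈V S ⊎ v ∈V S') f

{-# OPTIONS --safe #-}
-- First build a trade between two q-cliques on X and Y that share exactly the
-- r-edge e: an r-graph H, with no edge inside X or inside Y, such that H ∪ (K(X) ∖ e) and
-- H ∪ (K(Y) ∖ e) both have K_q^r-decompositions.  Enumerate X and Y so that they agree exactly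
-- on the first r positions and view the positions as q columns over ℤ/n, n = q! + 1, in which all
-- differences of column indices are invertible.  For k ∈ {0, 1}, the codewords
-- i ↦ a(i) + k·σ(i) with deg a < r and σ(i) = ∏_{j<r} (i − j) form a transversal design: any r
-- points in distinct columns lie on exactly one codeword.  Labelling the point (i, 0) by X's i-th
-- vertex, (i, σ(i)) by Y's i-th vertex (the same one when σ(i) = 0) and all other points by fresh
-- vertices, the zero codewords become X and Y, and both designs cover the same r-sets.  Then H is
-- the set of covered edges lying neither in X nor in Y: the first design without X decomposes
-- H ∪ (K(Y) ∖ e), the second without Y decomposes H ∪ (K(X) ∖ e).
--   For S₁ and S₂ on X₁ and X₂, let Y consist of e and q − r new vertices, take a trade H₁
-- between X₁ and Y and a trade H₂ between X₂ and Y on disjoint sets of fresh vertices, and put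
-- H = H₁ ∪ (K(Y) ∖ e) ∪ H₂.  Then H ∪ (S₁ ∖ e) is the disjoint union of H₁ ∪ (K(X₁) ∖ e) and
-- H₂ ∪ (K(Y) ∖ e), symmetrically for S₂, and every edge of H has a vertex outside X₁ ∪ X₂.
module Submission where

open import Defs
open import Data.Nat using (ℕ; zero; suc; _≤_; _<_; z≤n; s≤s; _≟_; NonZero; _!)
import Data.Nat as ℕ
import Data.Nat.Properties as ℕ
import Data.Nat.Divisibility as ℕ
open import Data.Nat.Coprimality using (Coprime; coprime-divisor)
open import Data.Nat.DivMod using (_%_; [m+kn]%n≡m%n; m<n⇒m%n≡m)
open import Data.Nat.ListAction using (sum)
open import Data.Fin using (Fin; zero; suc; toℕ; fromℕ<)
open import Data.Fin.Properties using (toℕ-injective; toℕ<n; toℕ-fromℕ<)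
open import Data.Integer using (ℤ; +_; _+_; _*_; -_; _-_; _^_; 0ℤ; 1ℤ; ∣_∣; _%ℕ_; _/ℕ_)
open import Data.Integer.Properties
  using ( +-identityˡ; +-identityʳ; *-identityˡ; *-zeroˡ; *-zeroʳ; +-inverseʳ; +-injective
        ; m-n≡m⊖n; ∣⊖∣-<; ∣m⊝n∣≤m⊔n; abs-*; ∣i∣≡0⇒i≡0; i-j≡0⇒i≡j)
open import Data.Integer.DivMod using (n%ℕd<d; a≡a%ℕn+[a/ℕn]*n)
open import Data.Integer.Divisibility.Signed
  using (_∣_; divides; ∣m∣n⇒∣m+n; ∣m∣n⇒∣m-n; ∣m⇒∣-m; ∣n⇒∣m*n; ∣⇒∣ᵤ; ∣ᵤ⇒∣)
open import Data.Integer.Tactic.RingSolver using (solve-∀)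
open import Data.List
  using ( List; []; _∷_; [_]; length; map; _++_; lookup; filter; deduplicate; concat; upTo; allFin; replicate
        ; cartesianProductWith)
open import Data.List.Properties
  using (≡-dec; length-map; length-++; length-tabulate; length-upTo; length-replicate; map-cong; map-replicate)
open import Data.List.Sort ℕ.≤-decTotalOrder using (sort; sort-↭; sort-↗)
open import Data.List.Relation.Unary.All as All using (All; []; _∷_; all?)
import Data.List.Relation.Unary.All.Properties as All
open import Data.List.Relation.Unary.AllPairs as AllPairs using (AllPairs; []; _∷_)
import Data.List.Relation.Unary.AllPairs.Properties as AllPairs
open import Data.List.Relation.Unary.Any as Any using (Any; here; there)
import Data.List.Relation.Unary.Any.Properties as Any
open import Data.List.Relation.Unary.Linked as Linked using (Linked; []; [-]; _∷_)
open import Data.List.Relation.Unary.Linked.Properties using (Linked⇒All; Linked⇒AllPairs)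
open import Data.List.Relation.Unary.Unique.Propositional using (Unique)
import Data.List.Relation.Unary.Unique.Propositional.Properties as Unique
open import Data.List.Relation.Unary.Unique.DecPropositional.Properties using (deduplicate-!)
open import Data.List.Relation.Binary.Disjoint.Propositional using (Disjoint)
open import Data.List.Relation.Binary.Permutation.Propositional using (↭-sym; ↭⇒↭ₛ)
open import Data.List.Relation.Binary.Permutation.Propositional.Properties using (∈-resp-↭; ↭-length)
import Data.List.Relation.Binary.Permutation.Setoid.Properties as PermutationSetoid
open import Data.List.Membership.Propositional using (_∈_; _∉_; lose; find)
open import Data.List.Membership.DecPropositional _≟_ using (_∈?_)
open import Data.List.Membership.Propositional.Properties
  using ( ∈-map⁺; ∈-map⁻; ∈-++⁺ˡ; ∈-++⁺ʳ; ∈-++⁻; ∈-upTo⁺; ∈-upTo⁻; ∈-allFin; ∈-lookup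
        ; ∈-filter⁺; ∈-filter⁻; ∈-deduplicate⁺; ∈-deduplicate⁻; ∈-concat⁺; ∈-concat⁻
        ; ∈-cartesianProductWith⁺; ∈-cartesianProductWith⁻)
open import Data.Product using (Σ; ∃-syntax; _×_; _,_; proj₁; proj₂; uncurry)
open import Data.Sum as Sum using (_⊎_; inj₁; inj₂)
open import Data.Empty using (⊥; ⊥-elim)
open import Relation.Binary.PropositionalEquality
  using (_≡_; _≢_; refl; sym; trans; cong; cong₂; subst; subst₂; ≢-sym; setoid; module ≡-Reasoning)
open import Relation.Binary.Definitions using (tri<; tri≈; tri>)
open import Relation.Nullary using (¬_; ¬?; Dec; yes; no)
open import Relation.Nullary.Decidable using (_×-dec_)
open import Function.Base using (_∘_)
open import Function.Bundles using (_⇔_; mk⇔; Equivalence)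
import Function.Properties.Equivalence as ⇔

private
  variable
    k q r i j v x : ℕ
    xs ys f : List ℕ
    P Q : EdgeSet

-- Strictly increasing lists as finite sets

Strict : List ℕ → Set
Strict = Linked _<_

head<tail : Strict (x ∷ xs) → All (x <_) xs
head<tail [-] = []
head<tail (x<y ∷ s) = Linked⇒All ℕ.<-trans x<y s

strict-∷ : All (x <_) xs → Strict xs → Strict (x ∷ xs)
strict-∷ [] _ = [-]
strict-∷ (x<y ∷ _) s = x<y ∷ s

strict⇒unique : Strict xs → Unique xs
strict⇒unique s = AllPairs.map ℕ.<⇒≢ (Linked⇒AllPairs ℕ.<-trans s)

∈-∷⁻ : v ≢ x → v ∈ x ∷ xs → v ∈ xs
∈-∷⁻ v≢x (here v≡x) = ⊥-elim (v≢x v≡x)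
∈-∷⁻ _ (there v∈xs) = v∈xs

head≤ : Strict (x ∷ xs) → v ∈ x ∷ xs → x ≤ v
head≤ _ (here refl) = ℕ.≤-refl
head≤ s (there v∈xs) = ℕ.<⇒≤ (All.lookup (head<tail s) v∈xs)

⊆-tail : All (x <_) f → All (_∈ x ∷ xs) f → All (_∈ xs) f
⊆-tail x<f f⊆ = All.tabulate λ v∈f → ∈-∷⁻ (ℕ.>⇒≢ (All.lookup x<f v∈f)) (All.lookup f⊆ v∈f)

strict-ext : Strict xs → Strict ys → (∀ {v} → v ∈ xs → v ∈ ys) → (∀ {v} → v ∈ ys → v ∈ xs) → xs ≡ ys
strict-ext {[]} {[]} _ _ _ _ = refl
strict-ext {[]} {_ ∷ _} _ _ _ ys⊆xs with () ← ys⊆xs (here refl)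
strict-ext {_ ∷ _} {[]} _ _ xs⊆ys _ with () ← xs⊆ys (here refl)
strict-ext {x ∷ xs} {y ∷ ys} sx sy xs⊆ys ys⊆xs
  with refl ← ℕ.≤-antisym (head≤ sx (ys⊆xs (here refl))) (head≤ sy (xs⊆ys (here refl))) =
  cong (x ∷_) (strict-ext (Linked.tail sx) (Linked.tail sy) (shrink sx xs⊆ys) (shrink sy ys⊆xs))
  where
  shrink : ∀ {as bs} → Strict (x ∷ as) → (∀ {v} → v ∈ x ∷ as → v ∈ x ∷ bs) → ∀ {v} → v ∈ as → v ∈ bs
  shrink s as⊆ v∈as = ∈-∷⁻ (ℕ.>⇒≢ (All.lookup (head<tail s) v∈as)) (as⊆ (there v∈as))

sorted-unique⇒strict : Linked _≤_ xs → Unique xs → Strict xs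
sorted-unique⇒strict [] _ = []
sorted-unique⇒strict [-] _ = [-]
sorted-unique⇒strict (x≤y ∷ s) ((x≢y ∷ _) ∷ u) = ℕ.≤∧≢⇒< x≤y x≢y ∷ sorted-unique⇒strict s u

sort-strict : Unique xs → Strict (sort xs)
sort-strict {xs} u = sorted-unique⇒strict (sort-↗ xs)
  (PermutationSetoid.Unique-resp-↭ (setoid ℕ) (↭⇒↭ₛ (↭-sym (sort-↭ xs))) u)

∈-sort⁺ : v ∈ xs → v ∈ sort xs
∈-sort⁺ {xs = xs} = ∈-resp-↭ (↭-sym (sort-↭ xs))

∈-sort⁻ : v ∈ sort xs → v ∈ xs
∈-sort⁻ {xs = xs} = ∈-resp-↭ (sort-↭ xs)

length-sort : ∀ xs → length (sort xs) ≡ length xs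
length-sort xs = ↭-length (sort-↭ xs)

combinations : ℕ → List ℕ → List (List ℕ)
combinations zero _ = [ [] ]
combinations (suc k) [] = []
combinations (suc k) (x ∷ xs) = map (x ∷_) (combinations k xs) ++ combinations (suc k) xs

∈-combinations⁻ : Strict xs → f ∈ combinations k xs → IsREdge k f × All (_∈ xs) f
∈-combinations⁻ {k = zero} _ (here refl) = ([] , refl) , []
∈-combinations⁻ {x ∷ xs} {k = suc k} s f∈ with ∈-++⁻ (map (x ∷_) (combinations k xs)) f∈
... | inj₁ f∈map with _ , g∈ , refl ← ∈-map⁻ (x ∷_) f∈map =
  let (sg , lg) , g⊆ = ∈-combinations⁻ (Linked.tail s) g∈
  in (strict-∷ (All.map (All.lookup (head<tail s)) g⊆) sg , cong suc lg) , here refl ∷ All.map there g⊆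
... | inj₂ f∈rest =
  let ef , f⊆ = ∈-combinations⁻ (Linked.tail s) f∈rest in ef , All.map there f⊆

∈-combinations⁺ : Strict xs → IsREdge k f → All (_∈ xs) f → f ∈ combinations k xs
∈-combinations⁺ {k = zero} {[]} _ _ _ = here refl
∈-combinations⁺ {x ∷ xs} {suc k} {y ∷ f} s (sf , refl) (here refl ∷ f⊆) =
  ∈-++⁺ˡ (∈-map⁺ (x ∷_) (∈-combinations⁺ (Linked.tail s) (Linked.tail sf , refl) (⊆-tail (head<tail sf) f⊆)))
∈-combinations⁺ {x ∷ xs} {suc k} {y ∷ f} s (sf , refl) (there y∈xs ∷ f⊆) =
  ∈-++⁺ʳ _ (∈-combinations⁺ (Linked.tail s) (sf , refl)
    (⊆-tail (x<y ∷ All.map (ℕ.<-trans x<y) (head<tail sf)) (there y∈xs ∷ f⊆)))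
  where x<y = All.lookup (head<tail s) y∈xs

combinations-clique : Strict xs → length xs ≡ q → IsClique q r (combinations r xs)
combinations-clique {xs} s len = xs , s , len , λ f →
  mk⇔ (∈-combinations⁻ s) (λ (ef , f⊆) → ∈-combinations⁺ s ef f⊆)

combinations-overlong : ∀ xs → length xs < k → combinations k xs ≡ []
combinations-overlong {suc k} [] _ = refl
combinations-overlong {suc k} (x ∷ xs) (s≤s len<k)
  rewrite combinations-overlong xs len<k | combinations-overlong xs (ℕ.m<n⇒m<1+n len<k) = refl

combinations-self : ∀ xs → combinations (length xs) xs ≡ [ xs ]
combinations-self [] = refl
combinations-self (x ∷ xs) rewrite combinations-self xs | combinations-overlong xs (ℕ.n<1+n (length xs)) = refl

edge-⊆⇒≡ : IsREdge r f → IsREdge r xs → All (_∈ xs) f → f ≡ xs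
edge-⊆⇒≡ {xs = xs} (sf , lf) (sxs , refl) f⊆
  with here f≡xs ← subst (_ ∈_) (combinations-self xs) (∈-combinations⁺ sxs (sf , lf) f⊆) = f≡xs

CoveredBy : ℕ → List (List ℕ) → EdgeSet
CoveredBy r Bs f = Any (λ b → f ∈ combinations r b) Bs

-- Decompositions

-- Decompositions given by the vertex sets of their cliques, with disjointness stated pairwise;
-- unlike HasDecomposition, they combine directly under disjoint unions.
record BlockDecomposition (q r : ℕ) (P : EdgeSet) : Set where
  field
    blocks   : List (List ℕ)
    isBlock  : All (λ b → Strict b × length b ≡ q) blocks
    disjoint : AllPairs (λ b b′ → Disjoint (combinations r b) (combinations r b′)) blocks
    covers   : ∀ f → P f ⇔ CoveredBy r blocks f

lookup-disjoint : ∀ {Ss : List RGraph} {i j} → AllPairs Disjoint Ss →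
                  f ∈ lookup Ss i → f ∈ lookup Ss j → i ≡ j
lookup-disjoint {Ss = _ ∷ _} {zero} {zero} _ _ _ = refl
lookup-disjoint {Ss = _ ∷ _} {zero} {suc j} (S# ∷ _) f∈S f∈ = ⊥-elim (All.lookup S# (∈-lookup j) (f∈S , f∈))
lookup-disjoint {Ss = _ ∷ _} {suc i} {zero} (S# ∷ _) f∈ f∈S = ⊥-elim (All.lookup S# (∈-lookup i) (f∈S , f∈))
lookup-disjoint {Ss = _ ∷ _} {suc i} {suc j} (_ ∷ d) f∈ f∈′ = cong suc (lookup-disjoint d f∈ f∈′)

blockDecomposition⇒decomposition : BlockDecomposition q r P → HasDecomposition q r P
blockDecomposition⇒decomposition {q} {r} {P} D =
  Ss , All.map⁺ (All.map (λ (s , len) → combinations-clique s len) isBlock) , sound , complete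
  where
  open BlockDecomposition D
  Ss = map (combinations r) blocks

  sound : ∀ i f → f ∈ lookup Ss i → P f
  sound i f f∈ = Equivalence.from (covers f) (Any.map⁻ {P = f ∈_} (lose (∈-lookup i) f∈))

  complete : ∀ f → P f → Σ (Fin (length Ss)) λ i → f ∈ lookup Ss i × (∀ j → f ∈ lookup Ss j → j ≡ i)
  complete f Pf = Any.index f∈Ss , Any.lookup-index f∈Ss ,
                  λ j f∈j → lookup-disjoint (AllPairs.map⁺ disjoint) f∈j (Any.lookup-index f∈Ss)
    where
    f∈Ss : Any (f ∈_) Ss
    f∈Ss = Any.map⁺ (Equivalence.to (covers f) Pf)

decomposition-resp : (∀ f → P f ⇔ Q f) → BlockDecomposition q r P → BlockDecomposition q r Q
decomposition-resp P⇔Q D = record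
  { blocks = blocks ; isBlock = isBlock ; disjoint = disjoint
  ; covers = λ f → ⇔.trans (⇔.sym (P⇔Q f)) (covers f) }
  where open BlockDecomposition D

decomposition-⊎ : BlockDecomposition q r P → BlockDecomposition q r Q → (∀ {f} → P f → ¬ Q f) →
                  BlockDecomposition q r (λ f → P f ⊎ Q f)
decomposition-⊎ {r = r} {P} {Q} D E P⊥Q = record
  { blocks   = D.blocks ++ E.blocks
  ; isBlock  = All.++⁺ D.isBlock E.isBlock
  ; disjoint = AllPairs.++⁺ D.disjoint E.disjoint
                 (All.tabulate λ b∈ → All.tabulate λ b′∈ (f∈b , f∈b′) →
                    P⊥Q (fromD (lose b∈ f∈b)) (fromE (lose b′∈ f∈b′)))
  ; covers   = λ f → mk⇔ (Sum.[ Any.++⁺ˡ ∘ toD , Any.++⁺ʳ D.blocks ∘ toE ])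
                         (Sum.map fromD fromE ∘ Any.++⁻ D.blocks)
  }
  where
  module D = BlockDecomposition D
  module E = BlockDecomposition E
  toD = λ {f} → Equivalence.to (D.covers f)
  fromD = λ {f} → Equivalence.from (D.covers f)
  toE = λ {f} → Equivalence.to (E.covers f)
  fromE = λ {f} → Equivalence.from (E.covers f)

allPairs-mapWith∈ : ∀ {A : Set} {R S : A → A → Set} {xs} → AllPairs R xs →
                    (∀ {x y} → x ∈ xs → y ∈ xs → R x y → S x y) → AllPairs S xs
allPairs-mapWith∈ [] _ = []
allPairs-mapWith∈ (Rx ∷ Rxs) R⇒S =
  All.tabulate (λ y∈ → R⇒S (here refl) (there y∈) (All.lookup Rx y∈)) ∷
  allPairs-mapWith∈ Rxs (λ x∈ y∈ → R⇒S (there x∈) (there y∈))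

Linear : ℕ → List (List ℕ) → Set
Linear r Bs = ∀ {b b′ f} → b ∈ Bs → b′ ∈ Bs → f ∈ combinations r b → f ∈ combinations r b′ → b ≡ b′

decomposition-minus-block : ∀ {Bs Z} → All (λ b → Strict b × length b ≡ q) Bs → Linear r Bs → Z ∈ Bs →
                            BlockDecomposition q r (λ f → CoveredBy r Bs f × ¬ All (_∈ Z) f)
decomposition-minus-block {q} {r} {Bs} {Z} valid linear Z∈Bs = record
  { blocks   = Cs
  ; isBlock  = All.tabulate (λ b∈ → All.lookup valid (proj₁ (∈Cs⁻ b∈)))
  ; disjoint = allPairs-mapWith∈ (AllPairs.filter⁺ _ (deduplicate-! _ Bs))
                 λ b∈ b′∈ b≢b′ (f∈b , f∈b′) → b≢b′ (linear (proj₁ (∈Cs⁻ b∈)) (proj₁ (∈Cs⁻ b′∈)) f∈b f∈b′)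
  ; covers   = λ f → mk⇔ to from
  }
  where
  _≟ₗ_ = ≡-dec _≟_
  Cs = filter (λ b → ¬? (b ≟ₗ Z)) (deduplicate _≟ₗ_ Bs)

  ∈Cs⁻ : ∀ {b} → b ∈ Cs → b ∈ Bs × b ≢ Z
  ∈Cs⁻ b∈ = let b∈dedup , b≢Z = ∈-filter⁻ _ b∈ in ∈-deduplicate⁻ _ Bs b∈dedup , b≢Z

  strict : ∀ {b} → b ∈ Bs → Strict b
  strict b∈ = proj₁ (All.lookup valid b∈)

  to : ∀ {f} → CoveredBy r Bs f × ¬ All (_∈ Z) f → CoveredBy r Cs f
  to (cov , f⊈Z) with b , b∈ , f∈b ← find cov =
    lose (∈-filter⁺ _ (∈-deduplicate⁺ _≟ₗ_ b∈) λ { refl → f⊈Z (proj₂ (∈-combinations⁻ {k = r} (strict b∈) f∈b)) }) f∈b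

  from : ∀ {f} → CoveredBy r Cs f → CoveredBy r Bs f × ¬ All (_∈ Z) f
  from cov with b , b∈ , f∈b ← find cov =
    let b∈Bs , b≢Z = ∈Cs⁻ b∈ in
    lose b∈Bs f∈b ,
    λ f⊆Z → b≢Z (linear b∈Bs Z∈Bs f∈b
      (∈-combinations⁺ (strict Z∈Bs) (proj₁ (∈-combinations⁻ {k = r} (strict b∈Bs) f∈b)) f⊆Z))

unionMinus⇔covered-outside : ∀ {r} {Covered : EdgeSet} {H : RGraph} {A B e} → Strict B →
  (∀ f → f ∈ H ⇔ (Covered f × ¬ All (_∈ A) f × ¬ All (_∈ B) f)) →
  (∀ {f} → IsREdge r f → All (_∈ B) f → Covered f) →
  (∀ {f} → IsREdge r f → All (_∈ A) f → All (_∈ B) f → f ≡ e) → All (_∈ A) e →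
  (∀ {f} → Covered f → IsREdge r f) → ∀ f → UnionMinus H (combinations r B) e f ⇔ (Covered f × ¬ All (_∈ A) f)
unionMinus⇔covered-outside {r} {A = A} {B} sB H⇔ KB⊆Cov A∩B≡e e⊆A Cov⇒edge f = mk⇔ to from
  where
  to : UnionMinus _ (combinations r B) _ f → _
  to (inj₁ f∈H) = let cov , f⊈A , _ = Equivalence.to (H⇔ f) f∈H in cov , f⊈A
  to (inj₂ (f∈KB , f≢e)) = let ef , f⊆B = ∈-combinations⁻ {k = r} sB f∈KB in
    KB⊆Cov ef f⊆B , λ f⊆A → f≢e (A∩B≡e ef f⊆A f⊆B)
  from : _ → UnionMinus _ (combinations r B) _ f
  from (cov , f⊈A) with all? (_∈? B) f
  ... | no f⊈B = inj₁ (Equivalence.from (H⇔ f) (cov , f⊈A , f⊈B))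
  ... | yes f⊆B = inj₂ (∈-combinations⁺ sB (Cov⇒edge cov) f⊆B , λ { refl → f⊈A e⊆A })

-- Polynomials over ℤ

Poly : Set
Poly = List ℤ

eval : Poly → ℤ → ℤ
eval [] x = 0ℤ
eval (c ∷ cs) x = c + x * eval cs x

infixl 6 _+ₚ_

_+ₚ_ : Poly → Poly → Poly
[] +ₚ bs = bs
(a ∷ as) +ₚ [] = a ∷ as
(a ∷ as) +ₚ (b ∷ bs) = a + b ∷ (as +ₚ bs)

scale : ℤ → Poly → Poly
scale c = map (c *_)

eval-+ₚ : ∀ as bs x → eval (as +ₚ bs) x ≡ eval as x + eval bs x
eval-+ₚ [] bs x = sym (+-identityˡ _)
eval-+ₚ (a ∷ as) [] x = sym (+-identityʳ _)
eval-+ₚ (a ∷ as) (b ∷ bs) x rewrite eval-+ₚ as bs x = regroup a b x (eval as x) (eval bs x)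
  where
  regroup : ∀ a b x u v → a + b + x * (u + v) ≡ a + x * u + (b + x * v)
  regroup = solve-∀

eval-scale : ∀ c as x → eval (scale c as) x ≡ c * eval as x
eval-scale c [] x = sym (*-zeroʳ c)
eval-scale c (a ∷ as) x rewrite eval-scale c as x = distrib c a x (eval as x)
  where
  distrib : ∀ c a x u → c * a + x * (c * u) ≡ c * (a + x * u)
  distrib = solve-∀

length-+ₚ : ∀ as bs → length bs ≤ length as → length (as +ₚ bs) ≡ length as
length-+ₚ [] [] _ = refl
length-+ₚ (a ∷ as) [] _ = refl
length-+ₚ (a ∷ as) (b ∷ bs) (s≤s len) = cong suc (length-+ₚ as bs len)

length-scale : ∀ c as → length (scale c as) ≡ length as
length-scale c = length-map (c *_)

divide : Poly → ℤ → Poly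
divide [] t = []
divide (c ∷ cs) t = cs +ₚ scale t (divide cs t)

eval-divide : ∀ P t x → eval P x ≡ eval P t + (x - t) * eval (divide P t) x
eval-divide [] t x = sym (trans (+-identityˡ _) (*-zeroʳ (x - t)))
eval-divide (c ∷ cs) t x
  rewrite eval-+ₚ cs (scale t (divide cs t)) x | eval-scale t (divide cs t) x | eval-divide cs t x =
  horner c t x (eval cs t) (eval (divide cs t) x)
  where
  horner : ∀ c t x p q → c + x * (p + (x - t) * q) ≡ c + t * p + (x - t) * (p + (x - t) * q + t * q)
  horner = solve-∀

length-divide : ∀ P t → length (divide P t) ≡ ℕ.pred (length P)
length-divide [] t = refl
length-divide (c ∷ cs) t = length-+ₚ cs (scale t (divide cs t))
  (ℕ.≤-trans (ℕ.≤-reflexive (trans (length-scale t (divide cs t)) (length-divide cs t))) ℕ.pred[n]≤n)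

-- Root counting modulo n, with cancellation by differences of nodes in place of a field.
module _ {n : ℕ} {Node : ℤ → Set}
         (cancel : ∀ {x y} → Node x → Node y → x ≢ y → ∀ z → + n ∣ (x - y) * z → + n ∣ z) where

  vanishes-everywhere : ∀ {I} → AllPairs _≢_ I → All Node I →
                        ∀ P → length P ≤ length I → All (λ t → + n ∣ eval P t) I → ∀ x → + n ∣ eval P x
  vanishes-everywhere [] [] [] z≤n [] x = divides 0ℤ refl
  vanishes-everywhere {t ∷ I} (t∉I ∷ uI) (Nt ∷ NI) P len (n∣Pt ∷ n∣PI) x =
    subst (+ n ∣_) (sym (eval-divide P t x))
      (∣m∣n⇒∣m+n n∣Pt (∣n⇒∣m*n (x - t) (vanishes-everywhere uI NI (divide P t) len′ n∣QI x)))
    where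
    len′ : length (divide P t) ≤ length I
    len′ = subst (_≤ length I) (sym (length-divide P t)) (ℕ.pred-mono-≤ len)

    difference : ∀ i → eval P i - eval P t ≡ (i - t) * eval (divide P t) i
    difference i rewrite eval-divide P t i = cancelˡ (eval P t) ((i - t) * eval (divide P t) i)
      where
      cancelˡ : ∀ a b → a + b - a ≡ b
      cancelˡ = solve-∀

    n∣QI : All (λ i → + n ∣ eval (divide P t) i) I
    n∣QI = All.tabulate λ {i} i∈I →
      cancel (All.lookup NI i∈I) Nt (≢-sym (All.lookup t∉I i∈I)) _
        (subst (+ n ∣_) (difference i) (∣m∣n⇒∣m-n (All.lookup n∣PI i∈I) n∣Pt))

vanishing : List ℤ → ℤ → ℤ
vanishing [] x = 1ℤ
vanishing (t ∷ I) x = (x - t) * vanishing I x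

vanishing-root : ∀ {t I} → t ∈ I → vanishing I t ≡ 0ℤ
vanishing-root {t} {_ ∷ I} (here refl) rewrite +-inverseʳ t = *-zeroˡ (vanishing I t)
vanishing-root {t} {s ∷ _} (there t∈I) rewrite vanishing-root t∈I = *-zeroʳ (t - s)

lowerCoeffs : List ℤ → Poly
lowerCoeffs [] = []
lowerCoeffs (t ∷ I) = (0ℤ ∷ lowerCoeffs I) +ₚ (scale (- t) (lowerCoeffs I) ++ [ - t ])

eval-∷ʳ : ∀ cs c x → eval (cs ++ [ c ]) x ≡ eval cs x + c * x ^ length cs
eval-∷ʳ [] c x = constant c x
  where
  constant : ∀ c x → c + x * 0ℤ ≡ 0ℤ + c * 1ℤ
  constant = solve-∀
eval-∷ʳ (a ∷ cs) c x rewrite eval-∷ʳ cs c x = shift a x (eval cs x) c (x ^ length cs)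
  where
  shift : ∀ a x u c p → a + x * (u + c * p) ≡ a + x * u + c * (x * p)
  shift = solve-∀

length-lowerCoeffs : ∀ I → length (lowerCoeffs I) ≡ length I
length-lowerCoeffs [] = refl
length-lowerCoeffs (t ∷ I) =
  trans (length-+ₚ (0ℤ ∷ lowerCoeffs I) (scale (- t) (lowerCoeffs I) ++ [ - t ]) (ℕ.≤-reflexive tail-length))
        (cong suc (length-lowerCoeffs I))
  where
  tail-length : length (scale (- t) (lowerCoeffs I) ++ [ - t ]) ≡ suc (length (lowerCoeffs I))
  tail-length = trans (length-++ (scale (- t) (lowerCoeffs I)))
                      (trans (ℕ.+-comm _ 1) (cong suc (length-scale (- t) (lowerCoeffs I))))

eval-lowerCoeffs : ∀ I x → eval (lowerCoeffs I) x + x ^ length I ≡ vanishing I x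
eval-lowerCoeffs [] x = +-identityˡ 1ℤ
eval-lowerCoeffs (t ∷ I) x
  rewrite eval-+ₚ (0ℤ ∷ lowerCoeffs I) (scale (- t) (lowerCoeffs I) ++ [ - t ]) x
        | eval-∷ʳ (scale (- t) (lowerCoeffs I)) (- t) x
        | eval-scale (- t) (lowerCoeffs I) x
        | length-scale (- t) (lowerCoeffs I)
        | length-lowerCoeffs I
        | sym (eval-lowerCoeffs I x) =
  expand x t (eval (lowerCoeffs I) x) (x ^ length I)
  where
  expand : ∀ x t u p → 0ℤ + x * u + (- t * u + - t * p) + x * p ≡ (x - t) * (u + p)
  expand = solve-∀

-- Residues modulo n

module Residues (n : ℕ) .{{_ : NonZero n}} where

  red : ℤ → ℕ
  red z = z %ℕ n

  red<n : ∀ z → red z < n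
  red<n z = n%ℕd<d z n

  n∣red-z : ∀ z → + n ∣ + red z - z
  n∣red-z z = divides (- (z /ℕ n)) (trans (cong (λ w → + red z - w) (a≡a%ℕn+[a/ℕn]*n z n))
                                          (cancel (+ red z) (z /ℕ n) (+ n)))
    where
    cancel : ∀ r q n → r - (r + q * n) ≡ - q * n
    cancel = solve-∀

  ∤-difference : ∀ {a b} → a < b → b < n → ¬ (+ n ∣ + a - + b)
  ∤-difference {a} {b} a<b b<n n∣a-b = ℕ.<⇒≱ (ℕ.≤-<-trans (ℕ.m∸n≤m b a) b<n)
    (ℕ.∣⇒≤ {{ℕ.>-nonZero (ℕ.m<n⇒0<n∸m a<b)}}
      (subst (n ℕ.∣_) (trans (cong ∣_∣ (m-n≡m⊖n a b)) (∣⊖∣-< a<b)) (∣⇒∣ᵤ n∣a-b)))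

  residues-injective : ∀ {a b} → a < n → b < n → + n ∣ + a - + b → a ≡ b
  residues-injective {a} {b} a<n b<n n∣a-b with ℕ.<-cmp a b
  ... | tri< a<b _ _ = ⊥-elim (∤-difference a<b b<n n∣a-b)
  ... | tri≈ _ a≡b _ = a≡b
  ... | tri> _ _ b<a = ⊥-elim (∤-difference b<a a<n (subst (+ n ∣_) (negate (+ a) (+ b)) (∣m⇒∣-m n∣a-b)))
    where
    negate : ∀ a b → - (a - b) ≡ b - a
    negate = solve-∀

  ∣⇒red≡ : ∀ a b → + n ∣ a - b → red a ≡ red b
  ∣⇒red≡ a b n∣a-b = residues-injective (red<n a) (red<n b)
    (subst (+ n ∣_) (telescope (+ red a) a b (+ red b))
      (∣m∣n⇒∣m+n (∣m∣n⇒∣m+n (n∣red-z a) n∣a-b) (∣m⇒∣-m (n∣red-z b))))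
    where
    telescope : ∀ ra a b rb → ra - a + (a - b) + - (rb - b) ≡ ra - rb
    telescope = solve-∀

  red≡⇒∣ : ∀ a b → red a ≡ red b → + n ∣ a - b
  red≡⇒∣ a b ra≡rb = subst (+ n ∣_) (telescope (+ red b) a b)
    (∣m∣n⇒∣m-n (n∣red-z b) (subst (λ r → + n ∣ + r - a) ra≡rb (n∣red-z a)))
    where
    telescope : ∀ r a b → r - b - (r - a) ≡ a - b
    telescope = solve-∀

  reduce : Poly → Poly
  reduce = map (λ c → + red c)

  eval-reduce : ∀ as x → + n ∣ eval (reduce as) x - eval as x
  eval-reduce [] x = divides 0ℤ refl
  eval-reduce (c ∷ cs) x = subst (+ n ∣_) (regroup (+ red c) c x (eval (reduce cs) x) (eval cs x))
    (∣m∣n⇒∣m+n (n∣red-z c) (∣n⇒∣m*n x (eval-reduce cs x)))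
    where
    regroup : ∀ r c x u v → r - c + x * (u - v) ≡ r + x * u - (c + x * v)
    regroup = solve-∀

  residuePolys : ℕ → List Poly
  residuePolys zero = [] ∷ []
  residuePolys (suc k) = cartesianProductWith _∷_ (map +_ (upTo n)) (residuePolys k)

  length-residuePolys : ∀ {k as} → as ∈ residuePolys k → length as ≡ k
  length-residuePolys {zero} (here refl) = refl
  length-residuePolys {suc k} as∈
    with _ , _ , _ , bs∈ , refl ← ∈-cartesianProductWith⁻ _∷_ (map +_ (upTo n)) (residuePolys k) as∈ =
    cong suc (length-residuePolys bs∈)

  reduce∈residuePolys : ∀ {k} as → length as ≡ k → reduce as ∈ residuePolys k
  reduce∈residuePolys {zero} [] refl = here refl
  reduce∈residuePolys {suc k} (c ∷ cs) refl =
    ∈-cartesianProductWith⁺ _∷_ (∈-map⁺ +_ (∈-upTo⁺ (red<n c))) (reduce∈residuePolys cs refl)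

∣! : ∀ {d q} → 1 ≤ d → d ≤ q → d ℕ.∣ q !
∣! {suc d} _ d≤q = ℕ.∣-trans (ℕ.m∣m*n (d !)) (ℕ.m≤n⇒m!∣n! d≤q)

coprime-!+1 : ∀ {d q} → 1 ≤ d → d ≤ q → Coprime (suc (q !)) d
coprime-!+1 {d} {q} 1≤d d≤q {k} (k∣q!+1 , k∣d) =
  ℕ.∣1⇒≡1 (ℕ.∣m+n∣m⇒∣n (subst (k ℕ.∣_) (ℕ.+-comm 1 (q !)) k∣q!+1) (ℕ.∣-trans k∣d (∣! 1≤d d≤q)))

-- 0 < ∣ i − j ∣ ≤ q divides q!, so it is coprime to q! + 1.
cancel-difference : ∀ {q i j} z → i < q → j < q → i ≢ j → + suc (q !) ∣ (+ i - + j) * z → + suc (q !) ∣ z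
cancel-difference {q} {i} {j} z i<q j<q i≢j n∣ = ∣ᵤ⇒∣ (coprime-divisor (coprime-!+1 1≤d d≤q)
  (subst (suc (q !) ℕ.∣_) (abs-* (+ i - + j) z) (∣⇒∣ᵤ n∣)))
  where
  d≤q : ∣ + i - + j ∣ ≤ q
  d≤q = subst (_≤ q) (cong ∣_∣ (sym (m-n≡m⊖n i j))) (ℕ.≤-trans (∣m⊝n∣≤m⊔n i j) (ℕ.<⇒≤ (ℕ.⊔-lub i<q j<q)))
  1≤d : 1 ≤ ∣ + i - + j ∣
  1≤d = ℕ.n≢0⇒n>0 λ d≡0 → i≢j (+-injective (i-j≡0⇒i≡j (+ i) (+ j) (∣i∣≡0⇒i≡0 d≡0)))

∤-vanishing : ∀ {q i} J → i < q → All (λ j → j < q × j ≢ i) J → ¬ (+ suc (q !) ∣ vanishing (map +_ J) (+ i))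
∤-vanishing {q} [] _ _ n∣1 = ℕ.<⇒≢ (ℕ.1≤n! q) (sym (ℕ.suc-injective (ℕ.∣1⇒≡1 (∣⇒∣ᵤ n∣1))))
∤-vanishing {q} {i} (j ∷ J) i<q ((j<q , j≢i) ∷ J-ok) n∣ =
  ∤-vanishing J i<q J-ok (cancel-difference _ i<q j<q (≢-sym j≢i) n∣)

mixed-radix-injective : ∀ {n} .{{_ : NonZero n}} {i j s t} → s < n → t < n →
                        s ℕ.+ i ℕ.* n ≡ t ℕ.+ j ℕ.* n → i ≡ j × s ≡ t
mixed-radix-injective {n} {i} {j} {s} {t} s<n t<n eq =
  ℕ.*-cancelʳ-≡ i j n (ℕ.+-cancelˡ-≡ s _ _ (trans eq (cong (ℕ._+ j ℕ.* n) (sym s≡t)))) , s≡t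
  where
  open ≡-Reasoning
  s≡t : s ≡ t
  s≡t = begin
    s                     ≡⟨ m<n⇒m%n≡m s<n ⟨
    s % n                 ≡⟨ [m+kn]%n≡m%n s i n ⟨
    (s ℕ.+ i ℕ.* n) % n   ≡⟨ cong (_% n) eq ⟩
    (t ℕ.+ j ℕ.* n) % n   ≡⟨ [m+kn]%n≡m%n t j n ⟩
    t % n                 ≡⟨ m<n⇒m%n≡m t<n ⟩
    t                     ∎

-- Trades from codes

-- The trade of the proof idea, for enumerations la and lb of X and Y that agree exactly on the
-- first r columns, with fresh vertices from lo on.
module CodeTrade {q r lo : ℕ} (la lb : Fin q → ℕ)
  (la-injective : ∀ {i j} → la i ≡ la j → i ≡ j)
  (lb-injective : ∀ {i j} → lb i ≡ lb j → i ≡ j)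
  (shared : ∀ {i} → toℕ i < r → la i ≡ lb i)
  (apart : ∀ {i j} → r ≤ toℕ j → la i ≢ lb j)
  (la<lo : ∀ i → la i < lo) (lb<lo : ∀ i → lb i < lo)
  where

  n : ℕ
  n = suc (q !)

  open Residues n

  σ : Fin q → ℤ
  σ i = vanishing (map +_ (upTo r)) (+ toℕ i)

  σ̄ : Fin q → ℕ
  σ̄ i = red (σ i)

  σ̄-shared : ∀ {i} → toℕ i < r → σ̄ i ≡ 0
  σ̄-shared i<r = cong red (vanishing-root (∈-map⁺ +_ (∈-upTo⁺ i<r)))

  σ̄-private : ∀ {i} → r ≤ toℕ i → σ̄ i ≢ 0
  σ̄-private {i} r≤i σ̄≡0 = ∤-vanishing (upTo r) (toℕ<n i)
    (All.tabulate λ j∈ → let j<r = ∈-upTo⁻ j∈ in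
      ℕ.<-≤-trans j<r (ℕ.≤-trans r≤i (ℕ.<⇒≤ (toℕ<n i))) , ℕ.<⇒≢ (ℕ.<-≤-trans j<r r≤i))
    (subst (+ n ∣_) (+-identityʳ (σ i)) (red≡⇒∣ (σ i) 0ℤ σ̄≡0))

  fresh : Fin q → ℕ → ℕ
  fresh i s = lo ℕ.+ (s ℕ.+ toℕ i ℕ.* n)

  label : Fin q → ℕ → ℕ
  label i s with s ≟ 0 | s ≟ σ̄ i
  ... | yes _ | _     = la i
  ... | no _  | yes _ = lb i
  ... | no _  | no _  = fresh i s

  data LabelView (i : Fin q) (s : ℕ) : ℕ → Set where
    left  : s ≡ 0 → LabelView i s (la i)
    right : s ≢ 0 → s ≡ σ̄ i → LabelView i s (lb i)
    new   : s ≢ 0 → s ≢ σ̄ i → LabelView i s (fresh i s)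

  label-view : ∀ i s → LabelView i s (label i s)
  label-view i s with s ≟ 0 | s ≟ σ̄ i
  ... | yes s≡0 | _       = left s≡0
  ... | no s≢0  | yes s≡σ̄ = right s≢0 s≡σ̄
  ... | no s≢0  | no s≢σ̄  = new s≢0 s≢σ̄

  right-private : ∀ {i s} → s ≢ 0 → s ≡ σ̄ i → r ≤ toℕ i
  right-private s≢0 s≡σ̄ = ℕ.≮⇒≥ λ i<r → s≢0 (trans s≡σ̄ (σ̄-shared i<r))

  old≢fresh : ∀ {u} i s → u < lo → u ≢ fresh i s
  old≢fresh _ _ u<lo refl = ℕ.<⇒≱ u<lo (ℕ.m≤m+n _ _)

  view-injective : ∀ {i j s t u w} → s < n → t < n → LabelView i s u → LabelView j t w → u ≡ w → i ≡ j × s ≡ t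
  view-injective _ _ (left s≡0) (left t≡0) eq = la-injective eq , trans s≡0 (sym t≡0)
  view-injective _ _ (left _) (right t≢0 t≡σ̄) eq = ⊥-elim (apart (right-private t≢0 t≡σ̄) eq)
  view-injective {j = j} {t = t} _ _ (left _) (new _ _) eq = ⊥-elim (old≢fresh j t (la<lo _) eq)
  view-injective _ _ (right s≢0 s≡σ̄) (left _) eq = ⊥-elim (apart (right-private s≢0 s≡σ̄) (sym eq))
  view-injective _ _ (right _ s≡σ̄) (right _ t≡σ̄) eq with refl ← lb-injective eq = refl , trans s≡σ̄ (sym t≡σ̄)
  view-injective {j = j} {t = t} _ _ (right _ _) (new _ _) eq = ⊥-elim (old≢fresh j t (lb<lo _) eq)
  view-injective {i} {s = s} _ _ (new _ _) (left _) eq = ⊥-elim (old≢fresh i s (la<lo _) (sym eq))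
  view-injective {i} {s = s} _ _ (new _ _) (right _ _) eq = ⊥-elim (old≢fresh i s (lb<lo _) (sym eq))
  view-injective s<n t<n (new _ _) (new _ _) eq =
    let i≡j , s≡t = mixed-radix-injective s<n t<n (ℕ.+-cancelˡ-≡ lo _ _ eq) in toℕ-injective i≡j , s≡t

  label-injective : ∀ i j {s t} → s < n → t < n → label i s ≡ label j t → i ≡ j × s ≡ t
  label-injective i j {s} {t} s<n t<n = view-injective s<n t<n (label-view i s) (label-view j t)

  label-σ̄ : ∀ i → label i (σ̄ i) ≡ lb i
  label-σ̄ i = view-σ̄ (label-view i (σ̄ i))
    where
    view-σ̄ : ∀ {u} → LabelView i (σ̄ i) u → u ≡ lb i
    view-σ̄ (left σ̄≡0) = shared (ℕ.≰⇒> λ r≤i → σ̄-private r≤i σ̄≡0)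
    view-σ̄ (right _ _) = refl
    view-σ̄ (new _ σ̄≢σ̄) = ⊥-elim (σ̄≢σ̄ refl)

  fresh<hi : ∀ i {s} → s < n → fresh i s < lo ℕ.+ q ℕ.* n
  fresh<hi i s<n = ℕ.+-monoʳ-< lo (ℕ.<-≤-trans (ℕ.+-monoˡ-< (toℕ i ℕ.* n) s<n) (ℕ.*-monoˡ-≤ n (toℕ<n i)))

  label-range : ∀ i {s} → s < n →
                label i s ≡ la i ⊎ label i s ≡ lb i ⊎ (lo ≤ label i s × label i s < lo ℕ.+ q ℕ.* n)
  label-range i {s} s<n = range (label-view i s)
    where
    range : ∀ {u} → LabelView i s u → u ≡ la i ⊎ u ≡ lb i ⊎ (lo ≤ u × u < lo ℕ.+ q ℕ.* n)
    range (left _) = inj₁ refl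
    range (right _ _) = inj₂ (inj₁ refl)
    range (new _ _) = inj₂ (inj₂ (ℕ.m≤m+n lo _ , fresh<hi i s<n))

  Codeword : Set
  Codeword = Fin q → ℕ

  Valid : Codeword → Set
  Valid c = ∀ i → c i < n

  labelling : Codeword → Fin q → ℕ
  labelling c i = label i (c i)

  block : Codeword → List ℕ
  block c = sort (map (labelling c) (allFin q))

  block-strict : ∀ {c} → Valid c → Strict (block c)
  block-strict valid =
    sort-strict (Unique.map⁺ (λ {i} {j} eq → proj₁ (label-injective i j (valid i) (valid j) eq)) (Unique.allFin⁺ q))

  length-block : ∀ c → length (block c) ≡ q
  length-block c = trans (length-sort _) (trans (length-map _ (allFin q)) (length-tabulate _))

  ∈-block⁺ : ∀ c i → labelling c i ∈ block c
  ∈-block⁺ c i = ∈-sort⁺ (∈-map⁺ (labelling c) (∈-allFin i))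

  ∈-block⁻ : ∀ c {v} → v ∈ block c → ∃[ i ] v ≡ labelling c i
  ∈-block⁻ c v∈ = let i , _ , v≡ = ∈-map⁻ (labelling c) (∈-sort⁻ v∈) in i , v≡

  block-cong : ∀ {c c′} → (∀ i → c i ≡ c′ i) → block c ≡ block c′
  block-cong c≗c′ = cong sort (map-cong (λ i → cong (label i) (c≗c′ i)) (allFin q))

  edge-columns : ∀ c {f} → All (_∈ block c) f → ∃[ I ] f ≡ map (labelling c) I
  edge-columns c [] = [] , refl
  edge-columns c (v∈ ∷ f⊆) =
    let i , v≡ = ∈-block⁻ c v∈ ; I , f≡ = edge-columns c f⊆ in i ∷ I , cong₂ _∷_ v≡ f≡

  columns-agree : ∀ {c c′} → Valid c → Valid c′ → ∀ I →
                  All (_∈ block c′) (map (labelling c) I) → All (λ i → c i ≡ c′ i) I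
  columns-agree vc vc′ [] [] = []
  columns-agree {c′ = c′} vc vc′ (i ∷ I) (v∈ ∷ f⊆) with j , v≡ ← ∈-block⁻ c′ v∈
    with refl , ci≡c′i ← label-injective i j (vc i) (vc′ j) v≡ = ci≡c′i ∷ columns-agree vc vc′ I f⊆

  agreeing-⊆-block : ∀ {c c′} I → All (λ i → c i ≡ c′ i) I → All (_∈ block c′) (map (labelling c) I)
  agreeing-⊆-block [] [] = []
  agreeing-⊆-block {c′ = c′} (i ∷ I) (ci≡c′i ∷ agree) =
    subst (_∈ block c′) (cong (label i) (sym ci≡c′i)) (∈-block⁺ c′ i) ∷ agreeing-⊆-block I agree

  codeword : ℤ → Poly → Codeword
  codeword k a i = red (eval a (+ toℕ i) + k * σ i)

  codeword-valid : ∀ k a → Valid (codeword k a)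
  codeword-valid k a i = red<n (eval a (+ toℕ i) + k * σ i)

  point : Fin q → ℤ
  point i = + toℕ i

  codeword-unique : ∀ k {a b} → length a ≡ r → length b ≡ r → ∀ {I} → length I ≡ r → Unique I →
                    All (λ i → codeword k a i ≡ codeword k b i) I → ∀ j → codeword k a j ≡ codeword k b j
  codeword-unique k {a} {b} len-a len-b {I} len-I unique-I agree j =
    ∣⇒red≡ (shifted a j) (shifted b j) (subst (+ n ∣_) (difference j)
      (vanishes-everywhere {n = n} cancel (Unique.map⁺ (λ eq → toℕ-injective (+-injective eq)) unique-I)
        (All.map⁺ (All.tabulate λ {i} _ → i , refl)) D len-D
        (All.map⁺ (All.map (λ {i} eq → subst (+ n ∣_) (sym (difference i)) (red≡⇒∣ (shifted a i) (shifted b i) eq))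
                           agree))
        (point j)))
    where
    D = a +ₚ scale (- 1ℤ) b
    shifted : Poly → Fin q → ℤ
    shifted p i = eval p (point i) + k * σ i

    difference : ∀ i → eval D (point i) ≡ (eval a (point i) + k * σ i) - (eval b (point i) + k * σ i)
    difference i rewrite eval-+ₚ a (scale (- 1ℤ) b) (point i) | eval-scale (- 1ℤ) b (point i) =
      shift (eval a (point i)) (eval b (point i)) (k * σ i)
      where
      shift : ∀ u w s → u + - 1ℤ * w ≡ (u + s) - (w + s)
      shift = solve-∀

    len-D : length D ≤ length (map point I)
    len-D = ℕ.≤-reflexive
      (trans (length-+ₚ a _ (ℕ.≤-reflexive (trans (length-scale (- 1ℤ) b) (trans len-b (sym len-a)))))
             (trans len-a (sym (trans (length-map point I) len-I))))

    cancel : ∀ {x y} → (∃[ i ] x ≡ point i) → (∃[ i ] y ≡ point i) → x ≢ y → ∀ z → + n ∣ (x - y) * z → + n ∣ z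
    cancel (i , refl) (j , refl) x≢y z = cancel-difference z (toℕ<n i) (toℕ<n j) (λ i≡j → x≢y (cong +_ i≡j))

  shared-points : List ℤ
  shared-points = map +_ (upTo r)

  -- σ and the vanishing polynomial of I are both monic of degree r, so their difference has
  -- degree < r, and on I it equals σ.
  interpolant : List (Fin q) → Poly
  interpolant I = lowerCoeffs shared-points +ₚ scale (- 1ℤ) (lowerCoeffs (map point I))

  length-shared-points : length shared-points ≡ r
  length-shared-points = trans (length-map +_ (upTo r)) (length-upTo r)

  length-interpolant : ∀ {I} → length I ≡ r → length (interpolant I) ≡ r
  length-interpolant {I} len-I = trans
    (length-+ₚ (lowerCoeffs shared-points) _ (ℕ.≤-reflexive (trans (length-scale (- 1ℤ) (lowerCoeffs (map point I)))
       (trans (length-lowerCoeffs (map point I)) (trans (length-map point I)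
       (trans len-I (sym (trans (length-lowerCoeffs shared-points) length-shared-points))))))))
    (trans (length-lowerCoeffs shared-points) length-shared-points)

  eval-interpolant : ∀ {I i} → length I ≡ r → i ∈ I → eval (interpolant I) (point i) ≡ σ i
  eval-interpolant {I} {i} len-I i∈I
    rewrite eval-+ₚ (lowerCoeffs shared-points) (scale (- 1ℤ) (lowerCoeffs (map point I))) (point i)
          | eval-scale (- 1ℤ) (lowerCoeffs (map point I)) (point i) =
    difference-of-monics (eval (lowerCoeffs shared-points) (point i)) (eval (lowerCoeffs (map point I)) (point i))
      (subst (λ m → eval (lowerCoeffs shared-points) (point i) + point i ^ m ≡ σ i) length-shared-points
             (eval-lowerCoeffs shared-points (point i)))
      (trans (subst (λ m → eval (lowerCoeffs (map point I)) (point i) + point i ^ m ≡ vanishing (map point I) (point i))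
                    (trans (length-map point I) len-I)
                    (eval-lowerCoeffs (map point I) (point i)))
             (vanishing-root (∈-map⁺ point i∈I)))
    where
    difference-of-monics : ∀ u w {p s} → u + p ≡ s → w + p ≡ 0ℤ → u + - 1ℤ * w ≡ s
    difference-of-monics u w {p} refl w+p≡0 =
      trans (regroup u w p) (trans (cong (λ d → (u + p) + - d) w+p≡0) (+-identityʳ (u + p)))
      where
      regroup : ∀ u w p → u + - 1ℤ * w ≡ (u + p) + - (w + p)
      regroup = solve-∀

  codeword-transfer : ∀ k k′ {a} → length a ≡ r → ∀ {I} → length I ≡ r →
                      ∃[ a′ ] a′ ∈ residuePolys r × All (λ i → codeword k a i ≡ codeword k′ a′ i) I
  codeword-transfer k k′ {a} len-a {I} len-I = reduce b , reduce∈residuePolys b len-b , All.tabulate agree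
    where
    b = a +ₚ scale (k - k′) (interpolant I)

    len-b : length b ≡ r
    len-b = trans (length-+ₚ a _ (ℕ.≤-reflexive (trans (length-scale (k - k′) (interpolant I))
                                                        (trans (length-interpolant {I} len-I) (sym len-a)))))
                  len-a

    eval-b : ∀ {i} → i ∈ I → eval b (point i) ≡ eval a (point i) + (k - k′) * σ i
    eval-b {i} i∈I = trans (eval-+ₚ a _ (point i))
      (cong (λ d → eval a (point i) + d) (trans (eval-scale (k - k′) (interpolant I) (point i))
                                         (cong ((k - k′) *_) (eval-interpolant len-I i∈I))))

    agree : ∀ {i} → i ∈ I → codeword k a i ≡ codeword k′ (reduce b) i
    agree {i} i∈I = ∣⇒red≡ (eval a (point i) + k * σ i) (eval (reduce b) (point i) + k′ * σ i)
      (subst (+ n ∣_) shift (∣m⇒∣-m (eval-reduce b (point i))))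
      where
      rebalance : ∀ ρ u k k′ s → - (ρ - (u + (k - k′) * s)) ≡ (u + k * s) - (ρ + k′ * s)
      rebalance = solve-∀
      shift : - (eval (reduce b) (point i) - eval b (point i)) ≡
              (eval a (point i) + k * σ i) - (eval (reduce b) (point i) + k′ * σ i)
      shift rewrite eval-b i∈I = rebalance (eval (reduce b) (point i)) (eval a (point i)) k k′ (σ i)

  design : ℤ → List (List ℕ)
  design k = map (λ a → block (codeword k a)) (residuePolys r)

  Covered : ℤ → EdgeSet
  Covered k = CoveredBy r (design k)

  ∈-design⁻ : ∀ {k b} → b ∈ design k → ∃[ a ] a ∈ residuePolys r × b ≡ block (codeword k a)
  ∈-design⁻ b∈ = ∈-map⁻ _ b∈

  design-blocks : ∀ k → All (λ b → Strict b × length b ≡ q) (design k)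
  design-blocks k = All.map⁺ (All.tabulate λ {a} _ → block-strict (codeword-valid k a) , length-block (codeword k a))

  edge-of-block : ∀ {c f} → Valid c → f ∈ combinations r (block c) →
                  IsREdge r f × ∃[ I ] f ≡ map (labelling c) I × Unique I × length I ≡ r
  edge-of-block {c} vc f∈ =
    let (sf , len-f) , f⊆ = ∈-combinations⁻ (block-strict vc) f∈
        I , f≡ = edge-columns c f⊆
    in (sf , len-f) , I , f≡ , Unique.map⁻ (subst Unique f≡ (strict⇒unique sf)) ,
       trans (sym (length-map (labelling c) I)) (trans (cong length (sym f≡)) len-f)

  design-linear : ∀ k → Linear r (design k)
  design-linear k {f = f} b∈ b′∈ f∈b f∈b′
    with a , a∈ , refl ← ∈-design⁻ {k} b∈ | a′ , a′∈ , refl ← ∈-design⁻ {k} b′∈ =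
    let _ , I , f≡ , unique-I , len-I = edge-of-block (codeword-valid k a) f∈b
        f⊆b′ = proj₂ (∈-combinations⁻ {k = r} (block-strict (codeword-valid k a′)) f∈b′)
        agree = columns-agree (codeword-valid k a) (codeword-valid k a′) I
                  (subst (All (_∈ block (codeword k a′))) f≡ f⊆b′)
    in block-cong (codeword-unique k {a} {a′} (length-residuePolys a∈) (length-residuePolys a′∈) len-I unique-I agree)

  covered-transfer : ∀ k k′ {f} → Covered k f → Covered k′ f
  covered-transfer k k′ cov with b , b∈ , f∈b ← find cov with a , a∈ , refl ← ∈-design⁻ {k} b∈ =
    let edge , I , f≡ , _ , len-I = edge-of-block (codeword-valid k a) f∈b
        a′ , a′∈ , agree = codeword-transfer k k′ {a} (length-residuePolys a∈) {I} len-I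
    in lose (∈-map⁺ _ a′∈) (∈-combinations⁺ (block-strict (codeword-valid k′ a′)) edge
         (subst (All (_∈ block (codeword k′ a′))) (sym f≡) (agreeing-⊆-block {codeword k a} {codeword k′ a′} I agree)))

  covered-edge : ∀ k {f} → Covered k f → IsREdge r f
  covered-edge k cov with b , b∈ , f∈b ← find cov with a , _ , refl ← ∈-design⁻ {k} b∈ =
    proj₁ (edge-of-block (codeword-valid k a) f∈b)

  covered-labels : ∀ k {f} → Covered k f →
    All (λ v → (∃[ i ] v ≡ la i) ⊎ (∃[ i ] v ≡ lb i) ⊎ (lo ≤ v × v < lo ℕ.+ q ℕ.* n)) f
  covered-labels k cov with b , b∈ , f∈b ← find cov with a , _ , refl ← ∈-design⁻ {k} b∈ =
    All.map classify (proj₂ (∈-combinations⁻ {k = r} (block-strict (codeword-valid k a)) f∈b))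
    where
    classify : ∀ {v} → v ∈ block (codeword k a) →
               (∃[ i ] v ≡ la i) ⊎ (∃[ i ] v ≡ lb i) ⊎ (lo ≤ v × v < lo ℕ.+ q ℕ.* n)
    classify v∈ with i , refl ← ∈-block⁻ (codeword k a) v∈ with label-range i (codeword-valid k a i)
    ... | inj₁ v≡la = inj₁ (i , v≡la)
    ... | inj₂ (inj₁ v≡lb) = inj₂ (inj₁ (i , v≡lb))
    ... | inj₂ (inj₂ v-fresh) = inj₂ (inj₂ v-fresh)

  zeroPoly : Poly
  zeroPoly = replicate r 0ℤ

  zeroPoly∈ : zeroPoly ∈ residuePolys r
  zeroPoly∈ = subst (_∈ residuePolys r) (map-replicate _ r 0ℤ) (reduce∈residuePolys zeroPoly (length-replicate r))

  eval-zero : ∀ m x → eval (replicate m 0ℤ) x ≡ 0ℤ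
  eval-zero zero x = refl
  eval-zero (suc m) x rewrite eval-zero m x = trans (+-identityˡ _) (*-zeroʳ x)

  X₀ Y₀ : List ℕ
  X₀ = block (codeword 0ℤ zeroPoly)
  Y₀ = block (codeword 1ℤ zeroPoly)

  codeword-X₀ : ∀ i → codeword 0ℤ zeroPoly i ≡ 0
  codeword-X₀ i rewrite eval-zero r (point i) = refl

  codeword-Y₀ : ∀ i → codeword 1ℤ zeroPoly i ≡ σ̄ i
  codeword-Y₀ i rewrite eval-zero r (point i) | *-identityˡ (σ i) = cong red (+-identityˡ (σ i))

  ∈-X₀ : ∀ {v} → v ∈ X₀ ⇔ (∃[ i ] v ≡ la i)
  ∈-X₀ = mk⇔ (λ v∈ → let i , v≡ = ∈-block⁻ (codeword 0ℤ zeroPoly) v∈ in i , trans v≡ (cong (label i) (codeword-X₀ i)))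
             (λ { (i , refl) → subst (_∈ X₀) (cong (label i) (codeword-X₀ i)) (∈-block⁺ (codeword 0ℤ zeroPoly) i) })

  ∈-Y₀ : ∀ {v} → v ∈ Y₀ ⇔ (∃[ i ] v ≡ lb i)
  ∈-Y₀ = mk⇔ (λ v∈ → let i , v≡ = ∈-block⁻ (codeword 1ℤ zeroPoly) v∈ in i , trans v≡ (labelling-Y₀ i))
             (λ { (i , refl) → subst (_∈ Y₀) (labelling-Y₀ i) (∈-block⁺ (codeword 1ℤ zeroPoly) i) })
    where
    labelling-Y₀ : ∀ i → labelling (codeword 1ℤ zeroPoly) i ≡ lb i
    labelling-Y₀ i = trans (cong (label i) (codeword-Y₀ i)) (label-σ̄ i)

  outside? : ∀ f → Dec (¬ All (_∈ X₀) f × ¬ All (_∈ Y₀) f)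
  outside? f = ¬? (all? (_∈? X₀) f) ×-dec ¬? (all? (_∈? Y₀) f)

  H : RGraph
  H = filter outside? (concat (map (combinations r) (design 0ℤ)))

  ∈-H : ∀ f → f ∈ H ⇔ (Covered 0ℤ f × ¬ All (_∈ X₀) f × ¬ All (_∈ Y₀) f)
  ∈-H f = mk⇔
    (λ f∈H → let f∈ , f⊈X₀ , f⊈Y₀ = ∈-filter⁻ outside? f∈H in
               Any.map⁻ (∈-concat⁻ (map (combinations r) (design 0ℤ)) f∈) , f⊈X₀ , f⊈Y₀)
    (λ (cov , f⊈X₀ , f⊈Y₀) → ∈-filter⁺ outside? (∈-concat⁺ (Any.map⁺ cov)) (f⊈X₀ , f⊈Y₀))

  decomposition-minus-X₀ : BlockDecomposition q r (λ f → Covered 0ℤ f × ¬ All (_∈ X₀) f)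
  decomposition-minus-X₀ = decomposition-minus-block (design-blocks 0ℤ) (design-linear 0ℤ) (∈-map⁺ _ zeroPoly∈)

  decomposition-minus-Y₀ : BlockDecomposition q r (λ f → Covered 1ℤ f × ¬ All (_∈ Y₀) f)
  decomposition-minus-Y₀ = decomposition-minus-block (design-blocks 1ℤ) (design-linear 1ℤ) (∈-map⁺ _ zeroPoly∈)

-- Trades between cliques sharing an edge

nth : List ℕ → ℕ → ℕ
nth [] _ = 0
nth (x ∷ xs) zero = x
nth (x ∷ xs) (suc i) = nth xs i

nth-∈ : i < length xs → nth xs i ∈ xs
nth-∈ {zero} {x ∷ xs} _ = here refl
nth-∈ {suc i} {x ∷ xs} (s≤s i<len) = there (nth-∈ i<len)

∈⇒nth : v ∈ xs → ∃[ i ] i < length xs × v ≡ nth xs i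
∈⇒nth (here refl) = 0 , s≤s z≤n , refl
∈⇒nth (there v∈xs) = let i , i<len , v≡ = ∈⇒nth v∈xs in suc i , s≤s i<len , v≡

nth-injective : Unique xs → i < length xs → j < length xs → nth xs i ≡ nth xs j → i ≡ j
nth-injective {x ∷ xs} {zero} {zero} _ _ _ _ = refl
nth-injective {x ∷ xs} {zero} {suc j} (x∉ ∷ _) _ (s≤s j<len) x≡ = ⊥-elim (All.lookup x∉ (nth-∈ j<len) x≡)
nth-injective {x ∷ xs} {suc i} {zero} (x∉ ∷ _) (s≤s i<len) _ ≡x = ⊥-elim (All.lookup x∉ (nth-∈ i<len) (sym ≡x))
nth-injective {x ∷ xs} {suc i} {suc j} (_ ∷ u) (s≤s i<len) (s≤s j<len) eq =
  cong suc (nth-injective u i<len j<len eq)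

nth-++ˡ : ∀ xs {ys} → i < length xs → nth (xs ++ ys) i ≡ nth xs i
nth-++ˡ {zero} (x ∷ xs) _ = refl
nth-++ˡ {suc i} (x ∷ xs) (s≤s i<len) = nth-++ˡ xs i<len

nth-++ʳ : ∀ xs {ys} → nth (xs ++ ys) (length xs ℕ.+ j) ≡ nth ys j
nth-++ʳ [] = refl
nth-++ʳ (x ∷ xs) = nth-++ʳ xs

record Enumeration (q : ℕ) (e X : List ℕ) : Set where
  field
    at        : Fin q → ℕ
    injective : ∀ {i j} → at i ≡ at j → i ≡ j
    image     : ∀ {v} → v ∈ X ⇔ (∃[ i ] v ≡ at i)
    prefix    : ∀ i → toℕ i < length e → at i ≡ nth e (toℕ i)
    suffix    : ∀ i → length e ≤ toℕ i → at i ∉ e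

enumerate : ∀ {q e X} → Strict X → length X ≡ q → Unique e → All (_∈ X) e → Enumeration q e X
enumerate {q} {e} {X} sX len-X unique-e e⊆X = record
  { at        = λ i → nth L (toℕ i)
  ; injective = λ {i} {j} eq → toℕ-injective (nth-injective unique-L (<len i) (<len j) eq)
  ; image     = mk⇔ (λ v∈X → let i , i<len , v≡ = ∈⇒nth (X⊆L v∈X) in
                       fromℕ< (subst (i <_) len-L i<len) , trans v≡ (cong (nth L) (sym (toℕ-fromℕ< _))))
                    λ { (i , refl) → L⊆X (nth-∈ (<len i)) }
  ; prefix    = λ i i<len → nth-++ˡ e i<len
  ; suffix    = suffix
  }
  where
  ∉e? = λ v → ¬? (v ∈? e)
  rest = filter ∉e? X
  L = e ++ rest

  unique-L : Unique L
  unique-L = Unique.++⁺ unique-e (Unique.filter⁺ ∉e? (strict⇒unique sX))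
    λ (v∈e , v∈rest) → proj₂ (∈-filter⁻ ∉e? {xs = X} v∈rest) v∈e

  L⊆X : ∀ {v} → v ∈ L → v ∈ X
  L⊆X v∈L = Sum.[ All.lookup e⊆X , (λ v∈rest → proj₁ (∈-filter⁻ ∉e? {xs = X} v∈rest)) ] (∈-++⁻ e v∈L)

  X⊆L : ∀ {v} → v ∈ X → v ∈ L
  X⊆L {v} v∈X with v ∈? e
  ... | yes v∈e = ∈-++⁺ˡ v∈e
  ... | no v∉e = ∈-++⁺ʳ e (∈-filter⁺ ∉e? v∈X v∉e)

  -- L lists X without repetitions, so sorting it gives back X.
  len-L : length L ≡ q
  len-L = trans (sym (length-sort L))
    (trans (cong length (strict-ext (sort-strict unique-L) sX (L⊆X ∘ ∈-sort⁻) (∈-sort⁺ ∘ X⊆L))) len-X)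

  <len : ∀ i → toℕ i < length L
  <len i = subst (toℕ i <_) (sym len-L) (toℕ<n i)

  suffix : ∀ i → length e ≤ toℕ i → nth L (toℕ i) ∉ e
  suffix i e≤i =
    subst (_∉ e) (trans (sym (nth-++ʳ {toℕ i ℕ.∸ length e} e {rest})) (cong (nth L) (ℕ.m+[n∸m]≡n e≤i)))
    (λ v∈e → proj₂ (∈-filter⁻ ∉e? {xs = X} (nth-∈ rest<)) v∈e)
    where
    rest< : toℕ i ℕ.∸ length e < length rest
    rest< = ℕ.+-cancelˡ-< (length e) _ _
      (subst₂ _<_ (sym (ℕ.m+[n∸m]≡n e≤i)) (length-++ e) (<len i))

record Trade (q r : ℕ) (X Y e : List ℕ) (lo hi : ℕ) : Set where
  field
    H              : RGraph
    isRGraph       : IsRGraph r H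
    ⊈X             : ∀ {f} → f ∈ H → ¬ All (_∈ X) f
    ⊈Y             : ∀ {f} → f ∈ H → ¬ All (_∈ Y) f
    vertices       : ∀ {f} → f ∈ H → All (λ v → v ∈ X ⊎ v ∈ Y ⊎ (lo ≤ v × v < hi)) f
    decompositionX : BlockDecomposition q r (UnionMinus H (combinations r X) e)
    decompositionY : BlockDecomposition q r (UnionMinus H (combinations r Y) e)

-- Opaque: later proofs use trades only through their fields, and letting the type checker unfold
-- the construction exhausts memory.
opaque
  trade : ∀ {q r X Y e lo} → Strict X → length X ≡ q → Strict Y → length Y ≡ q →
          IsREdge r e → All (_∈ X) e → All (_∈ Y) e → (∀ {v} → v ∈ X → v ∈ Y → v ∈ e) →
          All (_< lo) X → All (_< lo) Y → Trade q r X Y e lo (lo ℕ.+ q ℕ.* suc (q !))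
  trade {q} {r} {X} {Y} {e} {lo} sX len-X sY len-Y (se , len-e) e⊆X e⊆Y X∩Y⊆e X<lo Y<lo = record
    { H              = H
    ; isRGraph       = All.tabulate λ {f} f∈H → covered-edge 0ℤ (proj₁ (Equivalence.to (∈-H′ f) f∈H))
    ; ⊈X             = λ {f} f∈H → proj₁ (proj₂ (Equivalence.to (∈-H′ f) f∈H))
    ; ⊈Y             = λ {f} f∈H → proj₂ (proj₂ (Equivalence.to (∈-H′ f) f∈H))
    ; vertices       = λ {f} f∈H →
        All.map (Sum.map (Equivalence.from (image EX)) (Sum.map₁ (Equivalence.from (image EY))))
                (covered-labels 0ℤ (proj₁ (Equivalence.to (∈-H′ f) f∈H)))
    ; decompositionX = decomposition-resp
        (λ f → ⇔.sym (unionMinus⇔covered-outside sX (λ f → ⇔.trans (∈-H′ f) (swap f)) KX⊆Cov₁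
                        (λ ef f⊆Y f⊆X → edge-in-X∩Y ef f⊆X f⊆Y) e⊆Y (covered-edge 1ℤ) f))
        (subst (λ Z → BlockDecomposition q r (λ f → Covered 1ℤ f × ¬ All (_∈ Z) f)) Y₀≡Y decomposition-minus-Y₀)
    ; decompositionY = decomposition-resp
        (λ f → ⇔.sym (unionMinus⇔covered-outside sY ∈-H′ KY⊆Cov₀ edge-in-X∩Y e⊆X (covered-edge 0ℤ) f))
        (subst (λ Z → BlockDecomposition q r (λ f → Covered 0ℤ f × ¬ All (_∈ Z) f)) X₀≡X decomposition-minus-X₀)
    }
    where
    EX : Enumeration q e X
    EX = enumerate sX len-X (strict⇒unique se) e⊆X
    EY : Enumeration q e Y
    EY = enumerate sY len-Y (strict⇒unique se) e⊆Y
    open Enumeration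

    shared : ∀ {i} → toℕ i < r → at EX i ≡ at EY i
    shared {i} i<r = let i<e = subst (toℕ i <_) (sym len-e) i<r in
                     trans (prefix EX i i<e) (sym (prefix EY i i<e))

    apart : ∀ {i j} → r ≤ toℕ j → at EX i ≢ at EY j
    apart {i} {j} r≤j eq = suffix EY j (subst (_≤ toℕ j) (sym len-e) r≤j)
      (X∩Y⊆e (Equivalence.from (image EX) (i , sym eq)) (Equivalence.from (image EY) (j , refl)))

    open CodeTrade {q} {r} {lo} (at EX) (at EY) (injective EX) (injective EY) shared apart
      (λ i → All.lookup X<lo (Equivalence.from (image EX) (i , refl)))
      (λ i → All.lookup Y<lo (Equivalence.from (image EY) (i , refl)))

    X₀≡X : X₀ ≡ X
    X₀≡X = strict-ext (block-strict (codeword-valid 0ℤ zeroPoly)) sX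
      (Equivalence.from (image EX) ∘ Equivalence.to ∈-X₀) (Equivalence.from ∈-X₀ ∘ Equivalence.to (image EX))

    Y₀≡Y : Y₀ ≡ Y
    Y₀≡Y = strict-ext (block-strict (codeword-valid 1ℤ zeroPoly)) sY
      (Equivalence.from (image EY) ∘ Equivalence.to ∈-Y₀) (Equivalence.from ∈-Y₀ ∘ Equivalence.to (image EY))

    ∈-H′ : ∀ f → f ∈ H ⇔ (Covered 0ℤ f × ¬ All (_∈ X) f × ¬ All (_∈ Y) f)
    ∈-H′ f = subst₂ (λ A B → f ∈ H ⇔ (Covered 0ℤ f × ¬ All (_∈ A) f × ¬ All (_∈ B) f)) X₀≡X Y₀≡Y (∈-H f)

    swap : ∀ f → (Covered 0ℤ f × ¬ All (_∈ X) f × ¬ All (_∈ Y) f) ⇔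
                 (Covered 1ℤ f × ¬ All (_∈ Y) f × ¬ All (_∈ X) f)
    swap f = mk⇔ (λ (cov , f⊈X , f⊈Y) → covered-transfer 0ℤ 1ℤ cov , f⊈Y , f⊈X)
                 (λ (cov , f⊈Y , f⊈X) → covered-transfer 1ℤ 0ℤ cov , f⊈X , f⊈Y)

    edge-in-X∩Y : ∀ {f} → IsREdge r f → All (_∈ X) f → All (_∈ Y) f → f ≡ e
    edge-in-X∩Y ef f⊆X f⊆Y =
      edge-⊆⇒≡ ef (se , len-e) (All.zipWith (λ (v∈X , v∈Y) → X∩Y⊆e v∈X v∈Y) (f⊆X , f⊆Y))

    KX⊆Cov₁ : ∀ {f} → IsREdge r f → All (_∈ X) f → Covered 1ℤ f
    KX⊆Cov₁ ef f⊆X = covered-transfer 0ℤ 1ℤ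
      (lose (∈-map⁺ _ zeroPoly∈) (∈-combinations⁺ (block-strict (codeword-valid 0ℤ zeroPoly)) ef
        (subst (λ Z → All (_∈ Z) _) (sym X₀≡X) f⊆X)))

    KY⊆Cov₀ : ∀ {f} → IsREdge r f → All (_∈ Y) f → Covered 0ℤ f
    KY⊆Cov₀ ef f⊆Y = covered-transfer 1ℤ 0ℤ
      (lose (∈-map⁺ _ zeroPoly∈) (∈-combinations⁺ (block-strict (codeword-valid 1ℤ zeroPoly)) ef
        (subst (λ Z → All (_∈ Z) _) (sym Y₀≡Y) f⊆Y)))

-- The independent hinge

∈⇒≤sum : ∀ {v xs} → v ∈ xs → v ≤ sum xs
∈⇒≤sum {xs = x ∷ xs} (here refl) = ℕ.m≤m+n x (sum xs)
∈⇒≤sum {xs = x ∷ xs} (there v∈xs) = ℕ.≤-trans (∈⇒≤sum v∈xs) (ℕ.m≤n+m (sum xs) x)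

-- Otherwise swapping it for a vertex of e would give a second common edge.
shared-vertex∈edge : ∀ {r e X₁ X₂ v} → 1 ≤ r → IsREdge r e → All (_∈ X₁) e → All (_∈ X₂) e →
  (∀ {f} → IsREdge r f → All (_∈ X₁) f → All (_∈ X₂) f → f ≡ e) → v ∈ X₁ → v ∈ X₂ → v ∈ e
shared-vertex∈edge {e = []} 1≤r (_ , refl) = ⊥-elim (ℕ.<-irrefl refl 1≤r)
shared-vertex∈edge {r} {e₀ ∷ e′} {v = v} _ (se , len-e) (_ ∷ e′⊆X₁) (_ ∷ e′⊆X₂) only-e v∈X₁ v∈X₂
  with v ∈? e₀ ∷ e′
... | yes v∈e = v∈e
... | no v∉e = ⊥-elim (v∉e (subst (v ∈_) (only-e edge (⊆ e′⊆X₁ v∈X₁) (⊆ e′⊆X₂ v∈X₂)) (∈-sort⁺ (here refl))))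
  where
  unique : Unique (v ∷ e′)
  unique = All.tabulate (λ w∈e′ v≡w → v∉e (there (subst (_∈ e′) (sym v≡w) w∈e′)))
         ∷ strict⇒unique (Linked.tail se)

  edge : IsREdge r (sort (v ∷ e′))
  edge = sort-strict unique , trans (length-sort (v ∷ e′)) len-e

  ⊆ : ∀ {X} → All (_∈ X) e′ → v ∈ X → All (_∈ X) (sort (v ∷ e′))
  ⊆ e′⊆X v∈X = All.tabulate λ w∈ → case (∈-sort⁻ w∈)
    where
    case : ∀ {w} → w ∈ v ∷ e′ → w ∈ _
    case (here refl) = v∈X
    case (there w∈e′) = All.lookup e′⊆X w∈e′

clique-edges : ∀ {q r S} (clique : IsClique q r S) → ∀ {f} → f ∈ S ⇔ f ∈ combinations r (proj₁ clique)
clique-edges (X , sX , _ , S⇔) {f} =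
  ⇔.trans (S⇔ f) (mk⇔ (λ (ef , f⊆) → ∈-combinations⁺ sX ef f⊆) (∈-combinations⁻ sX))

module Construction {q r : ℕ} (1≤r : 1 ≤ r) (r<q : r < q) {S₁ S₂ : RGraph} {e : Edge}
  (clique₁ : IsClique q r S₁) (clique₂ : IsClique q r S₂)
  (S₁∩S₂≡e : ∀ f → (f ∈ S₁ × f ∈ S₂) ⇔ (f ≡ e)) where

  X₁ X₂ : List ℕ
  X₁ = proj₁ clique₁
  X₂ = proj₁ clique₂

  ⇔S₁ : ∀ {f} → f ∈ S₁ ⇔ (IsREdge r f × All (_∈ X₁) f)
  ⇔S₁ = proj₂ (proj₂ (proj₂ clique₁)) _

  ⇔S₂ : ∀ {f} → f ∈ S₂ ⇔ (IsREdge r f × All (_∈ X₂) f)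
  ⇔S₂ = proj₂ (proj₂ (proj₂ clique₂)) _

  e∈S₁×S₂ : e ∈ S₁ × e ∈ S₂
  e∈S₁×S₂ = Equivalence.from (S₁∩S₂≡e e) refl

  edge-e : IsREdge r e
  edge-e = proj₁ (Equivalence.to ⇔S₁ (proj₁ e∈S₁×S₂))

  e⊆X₁ : All (_∈ X₁) e
  e⊆X₁ = proj₂ (Equivalence.to ⇔S₁ (proj₁ e∈S₁×S₂))

  e⊆X₂ : All (_∈ X₂) e
  e⊆X₂ = proj₂ (Equivalence.to ⇔S₂ (proj₂ e∈S₁×S₂))

  X₁∩X₂⊆e : ∀ {v} → v ∈ X₁ → v ∈ X₂ → v ∈ e
  X₁∩X₂⊆e = shared-vertex∈edge 1≤r edge-e e⊆X₁ e⊆X₂ λ ef f⊆X₁ f⊆X₂ →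
    Equivalence.to (S₁∩S₂≡e _) (Equivalence.from ⇔S₁ (ef , f⊆X₁) , Equivalence.from ⇔S₂ (ef , f⊆X₂))

  -- Vertices below N₀ are old; Y adds new vertices below N₁, and the two trades use fresh
  -- vertices in [N₁, N₂) and [N₂, N₃).
  N₀ N₁ N₂ N₃ : ℕ
  N₀ = suc (sum (X₁ ++ X₂))
  N₁ = N₀ ℕ.+ q
  N₂ = N₁ ℕ.+ q ℕ.* suc (q !)
  N₃ = N₂ ℕ.+ q ℕ.* suc (q !)

  N₀≤N₁ : N₀ ≤ N₁
  N₀≤N₁ = ℕ.m≤m+n N₀ q

  N₀≤N₂ : N₀ ≤ N₂
  N₀≤N₂ = ℕ.≤-trans N₀≤N₁ (ℕ.m≤m+n N₁ _)

  Old : Edge → Set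
  Old = All (_< N₀)

  X₁-old : ∀ {v} → v ∈ X₁ → v < N₀
  X₁-old v∈X₁ = s≤s (∈⇒≤sum (∈-++⁺ˡ v∈X₁))

  X₂-old : ∀ {v} → v ∈ X₂ → v < N₀
  X₂-old v∈X₂ = s≤s (∈⇒≤sum (∈-++⁺ʳ X₁ v∈X₂))

  C : List ℕ
  C = map (N₀ ℕ.+_) (upTo (q ℕ.∸ r))

  Y : List ℕ
  Y = sort (e ++ C)

  C-new : ∀ {v} → v ∈ C → N₀ ≤ v × v < N₁
  C-new v∈C with k , k∈ , refl ← ∈-map⁻ (N₀ ℕ.+_) v∈C =
    ℕ.m≤m+n N₀ k , ℕ.+-monoʳ-< N₀ (ℕ.<-≤-trans (∈-upTo⁻ k∈) (ℕ.m∸n≤m q r))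

  strict-Y : Strict Y
  strict-Y = sort-strict (Unique.++⁺ (strict⇒unique (proj₁ edge-e))
    (Unique.map⁺ (ℕ.+-cancelˡ-≡ N₀ _ _) (Unique.upTo⁺ (q ℕ.∸ r)))
    λ (v∈e , v∈C) → ℕ.<⇒≱ (X₁-old (All.lookup e⊆X₁ v∈e)) (proj₁ (C-new v∈C)))

  length-Y : length Y ≡ q
  length-Y = trans (length-sort (e ++ C)) (trans (length-++ e)
    (trans (cong₂ ℕ._+_ (proj₂ edge-e) (trans (length-map _ (upTo (q ℕ.∸ r))) (length-upTo (q ℕ.∸ r))))
           (ℕ.m+[n∸m]≡n (ℕ.<⇒≤ r<q))))

  e⊆Y : All (_∈ Y) e
  e⊆Y = All.tabulate (∈-sort⁺ ∘ ∈-++⁺ˡ)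

  Y-old⇒e : ∀ {v} → v ∈ Y → v < N₀ → v ∈ e
  Y-old⇒e v∈Y v<N₀ with ∈-++⁻ e (∈-sort⁻ v∈Y)
  ... | inj₁ v∈e = v∈e
  ... | inj₂ v∈C = ⊥-elim (ℕ.<⇒≱ v<N₀ (proj₁ (C-new v∈C)))

  Y<N₁ : ∀ {v} → v ∈ Y → v < N₁
  Y<N₁ v∈Y with ∈-++⁻ e (∈-sort⁻ v∈Y)
  ... | inj₁ v∈e = ℕ.<-≤-trans (X₁-old (All.lookup e⊆X₁ v∈e)) N₀≤N₁
  ... | inj₂ v∈C = proj₂ (C-new v∈C)

  T₁ : Trade q r X₁ Y e N₁ N₂
  T₁ = trade (proj₁ (proj₂ clique₁)) (proj₁ (proj₂ (proj₂ clique₁))) strict-Y length-Y edge-e e⊆X₁ e⊆Y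
    (λ v∈X₁ v∈Y → Y-old⇒e v∈Y (X₁-old v∈X₁))
    (All.tabulate λ v∈X₁ → ℕ.<-≤-trans (X₁-old v∈X₁) N₀≤N₁) (All.tabulate Y<N₁)

  T₂ : Trade q r X₂ Y e N₂ N₃
  T₂ = trade (proj₁ (proj₂ clique₂)) (proj₁ (proj₂ (proj₂ clique₂))) strict-Y length-Y edge-e e⊆X₂ e⊆Y
    (λ v∈X₂ v∈Y → Y-old⇒e v∈Y (X₂-old v∈X₂))
    (All.tabulate λ v∈X₂ → ℕ.<-≤-trans (X₂-old v∈X₂) N₀≤N₂)
    (All.tabulate λ v∈Y → ℕ.<-≤-trans (Y<N₁ v∈Y) (ℕ.m≤m+n N₁ _))

  module T₁ = Trade T₁
  module T₂ = Trade T₂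

  Y-edge-old⇒e : ∀ {f} → f ∈ combinations r Y → Old f → f ≡ e
  Y-edge-old⇒e f∈KY old = let ef , f⊆Y = ∈-combinations⁻ strict-Y f∈KY in
    edge-⊆⇒≡ ef edge-e (All.zipWith (λ (v∈Y , v<N₀) → Y-old⇒e v∈Y v<N₀) (f⊆Y , old))

  T₁-new : ∀ {f} → f ∈ T₁.H → ¬ Old f
  T₁-new f∈H₁ old = T₁.⊈X f∈H₁ (All.zipWith (uncurry in-X₁) (T₁.vertices f∈H₁ , old))
    where
    in-X₁ : ∀ {v} → v ∈ X₁ ⊎ v ∈ Y ⊎ (N₁ ≤ v × v < N₂) → v < N₀ → v ∈ X₁
    in-X₁ (inj₁ v∈X₁) _ = v∈X₁
    in-X₁ (inj₂ (inj₁ v∈Y)) v<N₀ = All.lookup e⊆X₁ (Y-old⇒e v∈Y v<N₀)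
    in-X₁ (inj₂ (inj₂ (N₁≤v , _))) v<N₀ = ⊥-elim (ℕ.<⇒≱ v<N₀ (ℕ.≤-trans N₀≤N₁ N₁≤v))

  T₂-new : ∀ {f} → f ∈ T₂.H → ¬ Old f
  T₂-new f∈H₂ old = T₂.⊈X f∈H₂ (All.zipWith (uncurry in-X₂) (T₂.vertices f∈H₂ , old))
    where
    in-X₂ : ∀ {v} → v ∈ X₂ ⊎ v ∈ Y ⊎ (N₂ ≤ v × v < N₃) → v < N₀ → v ∈ X₂
    in-X₂ (inj₁ v∈X₂) _ = v∈X₂
    in-X₂ (inj₂ (inj₁ v∈Y)) v<N₀ = All.lookup e⊆X₂ (Y-old⇒e v∈Y v<N₀)
    in-X₂ (inj₂ (inj₂ (N₂≤v , _))) v<N₀ = ⊥-elim (ℕ.<⇒≱ v<N₀ (ℕ.≤-trans N₀≤N₂ N₂≤v))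

  -- A common edge would have a vertex outside Y, but the two trades only share vertices of Y.
  T₁∩T₂ : ∀ {f} → f ∈ T₁.H → f ∈ T₂.H → ⊥
  T₁∩T₂ f∈H₁ f∈H₂ = T₁.⊈Y f∈H₁ (All.zipWith (uncurry meet) (T₁.vertices f∈H₁ , T₂.vertices f∈H₂))
    where
    meet : ∀ {v} → v ∈ X₁ ⊎ v ∈ Y ⊎ (N₁ ≤ v × v < N₂) → v ∈ X₂ ⊎ v ∈ Y ⊎ (N₂ ≤ v × v < N₃) → v ∈ Y
    meet (inj₂ (inj₁ v∈Y)) _ = v∈Y
    meet _ (inj₂ (inj₁ v∈Y)) = v∈Y
    meet (inj₁ v∈X₁) (inj₁ v∈X₂) = All.lookup e⊆Y (X₁∩X₂⊆e v∈X₁ v∈X₂)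
    meet (inj₁ v∈X₁) (inj₂ (inj₂ (N₂≤v , _))) = ⊥-elim (ℕ.<⇒≱ (X₁-old v∈X₁) (ℕ.≤-trans N₀≤N₂ N₂≤v))
    meet (inj₂ (inj₂ (N₁≤v , _))) (inj₁ v∈X₂) = ⊥-elim (ℕ.<⇒≱ (X₂-old v∈X₂) (ℕ.≤-trans N₀≤N₁ N₁≤v))
    meet (inj₂ (inj₂ (_ , v<N₂))) (inj₂ (inj₂ (N₂≤v , _))) = ⊥-elim (ℕ.<⇒≱ v<N₂ N₂≤v)

  KY∖e : RGraph
  KY∖e = filter (λ f → ¬? (≡-dec _≟_ f e)) (combinations r Y)

  H : RGraph
  H = T₁.H ++ KY∖e ++ T₂.H

  ∈-H : ∀ {f} → f ∈ H ⇔ (f ∈ T₁.H ⊎ (f ∈ combinations r Y × f ≢ e) ⊎ f ∈ T₂.H)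
  ∈-H = mk⇔
    (λ f∈H → Sum.map₂ (Sum.map₁ (∈-filter⁻ (λ f → ¬? (≡-dec _≟_ f e))) ∘ ∈-++⁻ KY∖e) (∈-++⁻ T₁.H f∈H))
    Sum.[ ∈-++⁺ˡ , ∈-++⁺ʳ T₁.H ∘ Sum.[ ∈-++⁺ˡ ∘ uncurry (∈-filter⁺ _) , ∈-++⁺ʳ KY∖e ] ]

  H-new : ∀ {f} → f ∈ H → ¬ Old f
  H-new f∈H old with Equivalence.to ∈-H f∈H
  ... | inj₁ f∈H₁ = T₁-new f∈H₁ old
  ... | inj₂ (inj₁ (f∈KY , f≢e)) = f≢e (Y-edge-old⇒e f∈KY old)
  ... | inj₂ (inj₂ f∈H₂) = T₂-new f∈H₂ old

  H-isRGraph : IsRGraph r H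
  H-isRGraph = All.tabulate λ f∈H → case (Equivalence.to ∈-H f∈H)
    where
    case : ∀ {f} → f ∈ T₁.H ⊎ (f ∈ combinations r Y × f ≢ e) ⊎ f ∈ T₂.H → IsREdge r f
    case (inj₁ f∈H₁) = All.lookup T₁.isRGraph f∈H₁
    case (inj₂ (inj₁ (f∈KY , _))) = proj₁ (∈-combinations⁻ {k = r} strict-Y f∈KY)
    case (inj₂ (inj₂ f∈H₂)) = All.lookup T₂.isRGraph f∈H₂

  S₁-old : ∀ {f} → f ∈ S₁ → Old f
  S₁-old f∈S₁ = All.map X₁-old (proj₂ (Equivalence.to ⇔S₁ f∈S₁))

  S₂-old : ∀ {f} → f ∈ S₂ → Old f
  S₂-old f∈S₂ = All.map X₂-old (proj₂ (Equivalence.to ⇔S₂ f∈S₂))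

  independent : IndependentIn S₁ S₂ H
  independent f f∈H f⊆V = H-new f∈H (All.map old f⊆V)
    where
    old : ∀ {v} → v ∈V S₁ ⊎ v ∈V S₂ → v < N₀
    old (inj₁ (g , g∈S₁ , v∈g)) = All.lookup (S₁-old g∈S₁) v∈g
    old (inj₂ (g , g∈S₂ , v∈g)) = All.lookup (S₂-old g∈S₂) v∈g

  decomposition₁ : BlockDecomposition q r (UnionMinus H S₁ e)
  decomposition₁ =
    decomposition-resp (λ f → mk⇔ to from) (decomposition-⊎ T₁.decompositionX T₂.decompositionY apart)
    where
    Left Right : EdgeSet
    Left = UnionMinus T₁.H (combinations r X₁) e
    Right = UnionMinus T₂.H (combinations r Y) e

    apart : ∀ {f} → Left f → ¬ Right f
    apart (inj₁ f∈H₁) (inj₁ f∈H₂) = T₁∩T₂ f∈H₁ f∈H₂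
    apart (inj₁ f∈H₁) (inj₂ (f∈KY , _)) = T₁.⊈Y f∈H₁ (proj₂ (∈-combinations⁻ {k = r} strict-Y f∈KY))
    apart (inj₂ (f∈KX₁ , _)) (inj₁ f∈H₂) = T₂-new f∈H₂ (S₁-old (Equivalence.from (clique-edges clique₁) f∈KX₁))
    apart (inj₂ (f∈KX₁ , f≢e)) (inj₂ (f∈KY , _)) =
      f≢e (Y-edge-old⇒e f∈KY (S₁-old (Equivalence.from (clique-edges clique₁) f∈KX₁)))

    to : ∀ {f} → Left f ⊎ Right f → UnionMinus H S₁ e f
    to (inj₁ (inj₁ f∈H₁)) = inj₁ (Equivalence.from ∈-H (inj₁ f∈H₁))
    to (inj₁ (inj₂ (f∈KX₁ , f≢e))) = inj₂ (Equivalence.from (clique-edges clique₁) f∈KX₁ , f≢e)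
    to (inj₂ (inj₁ f∈H₂)) = inj₁ (Equivalence.from ∈-H (inj₂ (inj₂ f∈H₂)))
    to (inj₂ (inj₂ f∈KY∖e)) = inj₁ (Equivalence.from ∈-H (inj₂ (inj₁ f∈KY∖e)))

    from : ∀ {f} → UnionMinus H S₁ e f → Left f ⊎ Right f
    from (inj₂ (f∈S₁ , f≢e)) = inj₁ (inj₂ (Equivalence.to (clique-edges clique₁) f∈S₁ , f≢e))
    from (inj₁ f∈H) with Equivalence.to ∈-H f∈H
    ... | inj₁ f∈H₁ = inj₁ (inj₁ f∈H₁)
    ... | inj₂ (inj₁ f∈KY∖e) = inj₂ (inj₂ f∈KY∖e)
    ... | inj₂ (inj₂ f∈H₂) = inj₂ (inj₁ f∈H₂)

  decomposition₂ : BlockDecomposition q r (UnionMinus H S₂ e)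
  decomposition₂ =
    decomposition-resp (λ f → mk⇔ to from) (decomposition-⊎ T₁.decompositionY T₂.decompositionX apart)
    where
    Left Right : EdgeSet
    Left = UnionMinus T₁.H (combinations r Y) e
    Right = UnionMinus T₂.H (combinations r X₂) e

    apart : ∀ {f} → Left f → ¬ Right f
    apart (inj₁ f∈H₁) (inj₁ f∈H₂) = T₁∩T₂ f∈H₁ f∈H₂
    apart (inj₁ f∈H₁) (inj₂ (f∈KX₂ , _)) = T₁-new f∈H₁ (S₂-old (Equivalence.from (clique-edges clique₂) f∈KX₂))
    apart (inj₂ (f∈KY , _)) (inj₁ f∈H₂) = T₂.⊈Y f∈H₂ (proj₂ (∈-combinations⁻ {k = r} strict-Y f∈KY))
    apart (inj₂ (f∈KY , f≢e)) (inj₂ (f∈KX₂ , _)) =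
      f≢e (Y-edge-old⇒e f∈KY (S₂-old (Equivalence.from (clique-edges clique₂) f∈KX₂)))

    to : ∀ {f} → Left f ⊎ Right f → UnionMinus H S₂ e f
    to (inj₁ (inj₁ f∈H₁)) = inj₁ (Equivalence.from ∈-H (inj₁ f∈H₁))
    to (inj₁ (inj₂ f∈KY∖e)) = inj₁ (Equivalence.from ∈-H (inj₂ (inj₁ f∈KY∖e)))
    to (inj₂ (inj₁ f∈H₂)) = inj₁ (Equivalence.from ∈-H (inj₂ (inj₂ f∈H₂)))
    to (inj₂ (inj₂ (f∈KX₂ , f≢e))) = inj₂ (Equivalence.from (clique-edges clique₂) f∈KX₂ , f≢e)

    from : ∀ {f} → UnionMinus H S₂ e f → Left f ⊎ Right f
    from (inj₂ (f∈S₂ , f≢e)) = inj₂ (inj₂ (Equivalence.to (clique-edges clique₂) f∈S₂ , f≢e))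
    from (inj₁ f∈H) with Equivalence.to ∈-H f∈H
    ... | inj₁ f∈H₁ = inj₁ (inj₁ f∈H₁)
    ... | inj₂ (inj₁ f∈KY∖e) = inj₁ (inj₂ f∈KY∖e)
    ... | inj₂ (inj₂ f∈H₂) = inj₂ (inj₁ f∈H₂)

lemma2p5 : (q r : ℕ) → 1 ≤ r → r < q →
    (S₁ S₂ : RGraph) (e : Edge) →
    IsClique q r S₁ → IsClique q r S₂ →
    (∀ f → (f ∈ S₁ × f ∈ S₂) ⇔ (f ≡ e)) →
    ∃[ H ] (IsHinge q r S₁ S₂ e H × IndependentIn S₁ S₂ H)
lemma2p5 q r 1≤r r<q S₁ S₂ e clique₁ clique₂ S₁∩S₂≡e =
  H , (H-isRGraph , (λ f f∈H → H-new f∈H ∘ S₁-old , H-new f∈H ∘ S₂-old) ,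
       blockDecomposition⇒decomposition decomposition₁ , blockDecomposition⇒decomposition decomposition₂) ,
  independent
  where open Construction 1≤r r<q clique₁ clique₂ S₁∩S₂≡e
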